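{- For $p,q\ge1$, $\sigma\in S_p$ and $\tau\in S_q$ one has $$\sigma\prec\tau=\sum_{(1_{p-1}\vee1_q)\cdot(\sigma\times\tau)\le\omega\le\sigma\backslash\tau}\omega\qquad\text{and}\qquad\sigma\succ\tau=\sum_{\sigma/\tau\le\omega\le(\xi_{p,q-1}\times1_1)\cdot(\sigma\times\tau)}\omega,$$ the sums ranging over $\omega\in S_{p+q}$ and $\le$ being the weak order.
   Context: $S_n$ is the symmetric group on $\{1,\dots,n\}$ ($S_0$ contains only the empty permutation), product $(\sigma\cdot\tau)(i)=\sigma(\tau(i))$, unit $1_n$, $s_i=(i\ i+1)$, $l$ the length with respect to the $s_i$. Weak order: $\omega\le\sigma$ iff $\sigma=\tau\cdot\omega$ with $l(\sigma)=l(\tau)+l(\omega)$. $(\sigma\times\tau)(i)=\sigma(i)$ ($i\le p$), $=p+\tau(i-p)$ ($i>p$). Grafting $\sigma\vee\tau\in S_{p+q+1}$ for $\sigma\in S_p,\tau\in S_q$: $(\sigma\vee\tau)(i)=\sigma(i)$ for $i\le p$, $=p+q+1$ for $i=p+1$, $=\tau(i-p-1)+p$ for $i\ge p+2$. $\xi_{p,q}\in S_{p+q}$: $\xi_{p,q}(i)=q+i$ ($1\le i\le p$), $\xi_{p,q}(p+j)=j$ ($1\le j\le q$). $\sigma/\tau=\sigma\times\tau$, $\sigma\backslash\tau=\xi_{p,q}\cdot(\sigma\times\tau)$. $Sh(p,q)$: $\omega\in S_{p+q}$ with $\omega(1)<\dots<\omega(p)$, $\omega(p+1)<\dots<\omega(p+q)$;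 $Sh^1(p,q)=\{\omega\in Sh(p,q):\omega(p+q)=p+q\}$, $Sh^2(p,q)=\{\omega\in Sh(p,q):\omega(p)=p+q\}$; $\sigma\prec\tau=\sum_{\omega\in Sh^2(p,q)}\omega\cdot(\sigma\times\tau)$, $\sigma\succ\tau=\sum_{\omega\in Sh^1(p,q)}\omega\cdot(\sigma\times\tau)$. -}

module Defs where

open import Data.Nat using (ℕ; zero; suc; _+_; _<_)
open import Data.Nat.Properties using (+-assoc; +-comm)
open import Data.Fin as F using (Fin; zero; suc; toℕ; splitAt)
open import Data.Vec using (Vec; lookup; tabulate)
open import Data.Sum using ([_,_]′)
open import Data.Product using (Σ; _×_; _,_)
open import Relation.Binary.PropositionalEquality using (_≡_; _≢_; sym; trans; cong)
open import Relation.Nullary using (¬_)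

-- A (candidate) element of S_n, in one-line notation, 0-based:
-- the entry at position i (0-based) is the 0-based value of w(i+1).
Word : ℕ → Set
Word n = Vec (Fin n) n

IsPerm : ∀ {n} → Word n → Set
IsPerm w = ∀ i j → lookup w i ≡ lookup w j → i ≡ j

infixl 7 _·_
_·_ : ∀ {n} → Word n → Word n → Word n
σ · τ = tabulate (λ i → lookup σ (lookup τ i))

one : ∀ n → Word n
one n = tabulate (λ i → i)

castW : ∀ {n m} → n ≡ m → Word n → Word m
castW eq w = tabulate (λ i → F.cast eq (lookup w (F.cast (sym eq) i)))

infixl 8 _×ₚ_
_×ₚ_ : ∀ {p q} → Word p → Word q → Word (p + q)
_×ₚ_ {p} {q} σ τ =
  tabulate (λ i → [ (λ a → ((lookup σ a) F.↑ˡ q)) , (λ b → (p F.↑ʳ (lookup τ b))) ]′ (splitAt p i))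

-- grafting σ ∨ τ ∈ S_{p+q+1}  (p+q+1 written suc (p+q))
-- positions 1..p ↦ σ, position p+1 ↦ p+q+1, positions ≥ p+2 ↦ τ(i-p-1)+p
vee : ∀ {p q} → Word p → Word q → Word (suc (p + q))
vee {p} {q} σ τ = castW (+-suc' p q) (tabulate f)
  where
  +-suc' : ∀ m n → m + suc n ≡ suc (m + n)
  +-suc' zero n = _≡_.refl
  +-suc' (suc m) n = cong suc (+-suc' m n)
  f : Fin (p + suc q) → Fin (p + suc q)
  f i = [ (λ a → ((lookup σ a) F.↑ˡ (suc q)))
        , (λ { zero → (p F.↑ʳ (F.fromℕ q)) ; (suc b) → (p F.↑ʳ (F.inject₁ (lookup τ b))) }) ]′ (splitAt p i)

-- ξ_{p,q}: i ↦ q+i (i ≤ p), p+j ↦ j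
ξ : ∀ p q → Word (p + q)
ξ p q = tabulate (λ i → [ (λ a → F.cast (+-comm q p) ((q F.↑ʳ a)))
                         , (λ b → F.cast (+-comm q p) ((b F.↑ˡ p))) ]′ (splitAt p i))

_/ₚ_ : ∀ {p q} → Word p → Word q → Word (p + q)
σ /ₚ τ = σ ×ₚ τ

_∖ₚ_ : ∀ {p q} → Word p → Word q → Word (p + q)
_∖ₚ_ {p} {q} σ τ = ξ p q · (σ ×ₚ τ)

-- adjacent transposition: swapAdj j swaps the 0-based values j and j+1
-- (i.e. the 1-based s_{j+1}); identity when out of range
swapAdj : ∀ {n} → ℕ → Fin n → Fin n
swapAdj {suc (suc n)} zero zero = suc zero
swapAdj {suc (suc n)} zero (suc zero) = zero
swapAdj {suc n} (suc j) zero = zero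
swapAdj {suc n} (suc j) (suc k) = suc (swapAdj j k)
swapAdj j k = k

gen : ∀ n → ℕ → Word n
gen n j = tabulate (swapAdj j)

data Prod (n : ℕ) : ℕ → Word n → Set where
  ε   : Prod n 0 (one n)
  cons : ∀ {k w} (j : ℕ) → suc j < n → Prod n k w → Prod n (suc k) (gen n j · w)

HasLength : ∀ {n} → Word n → ℕ → Set
HasLength {n} w k = Prod n k w × (∀ j → j < k → ¬ Prod n j w)

infix 4 _≤w_
_≤w_ : ∀ {n} → Word n → Word n → Set
_≤w_ {n} ω σ = Σ (Word n) λ τ → IsPerm τ × σ ≡ τ · ω ×
  Σ ℕ λ a → Σ ℕ λ b → HasLength τ a × HasLength ω b × HasLength σ (a + b)

IsShuffle : ∀ p q → Word (p + q) → Set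
IsShuffle p q ω =
  (∀ (a b : Fin p) → toℕ a < toℕ b → toℕ (lookup ω ((a F.↑ˡ q))) < toℕ (lookup ω ((b F.↑ˡ q)))) ×
  (∀ (a b : Fin q) → toℕ a < toℕ b → toℕ (lookup ω ((p F.↑ʳ a))) < toℕ (lookup ω ((p F.↑ʳ b))))

-- Sh¹(p,q): ω(p+q) = p+q ;  Sh²(p,q): ω(p) = p+q   (1-based)
Sh¹ : ∀ p q → Word (p + q) → Set
Sh¹ p q ω = IsShuffle p q ω × (∀ i → suc (toℕ i) ≡ p + q → suc (toℕ (lookup ω i)) ≡ p + q)

Sh² : ∀ p q → Word (p + q) → Set
Sh² p q ω = IsShuffle p q ω × (∀ i → suc (toℕ i) ≡ p → suc (toℕ (lookup ω i)) ≡ p + q)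

-- Equality of formal sums in the free module on S_n:
--   Σ_{ω ∈ S_n, A ω} f(ω)  =  Σ_{ω ∈ S_n, B ω} ω
-- i.e. for every π ∈ S_n the coefficient of π on the left, the number of
-- ω ∈ S_n with A ω and f ω = π, equals the coefficient on the right
-- (1 if B π, 0 otherwise).
SumEq : ∀ n → (A : Word n → Set) → (Word n → Word n) → (B : Word n → Set) → Set
SumEq n A f B = ∀ (π : Word n) → IsPerm π →
  (B π → Σ (Word n) λ ω → (IsPerm ω × A ω × f ω ≡ π) ×
                         (∀ ω' → IsPerm ω' → A ω' → f ω' ≡ π → ω' ≡ ω)) ×
  (¬ B π → ∀ ω → IsPerm ω → A ω → f ω ≢ π)

-- (p + q) + 1 ≡ p + suc q, to view ξ_{p,q-1} × 1_1 in S_{p+q}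
assoc1 : ∀ p q → p + q + 1 ≡ p + suc q
assoc1 p q = trans (+-assoc p q 1) (cong (p +_) (+-comm q 1))

{-# OPTIONS --safe #-}

-- Left multiplication by s_j exchanges the values j and j + 1, so it adds or removes exactly one
-- inversion (pair of positions i < k with w k < w i).  Hence l(w) is the number of inversions, and
-- ω ≤ π in the weak order iff every inversion of ω is one of π: if π has more, some adjacent values
-- j + 1, j of π appear in this order at positions that ω does not invert, and s_j · π is one step
-- closer to ω.
--
-- Let x = σ × τ.  A shuffle ω keeps the order inside each block, so ω · x has the inversions of x
-- inside the blocks and differs from it only across them; conversely, if the inversions of π lie
-- between those of two such products, π · x⁻¹ is a shuffle.  The condition ω(p) = p + q says that
-- ω · x has every cross-block inversion of (1_{p-1} ∨ 1_q) · x, and ω(p + q) = p + q that it has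
-- none missing from (ξ_{p,q-1} × 1_1) · x, so ω ↦ ω · x maps Sh² and Sh¹ bijectively onto the two
-- intervals.

module Submission where

open import Defs
open import Data.Nat using (ℕ; zero; suc; _+_; _<_; _≤_; _≤′_; ≤′-refl; ≤′-step; z≤n; s≤s; z<s; s<s; _<?_)
open import Data.Nat.Properties
open import Data.Fin as F using (Fin; zero; suc; toℕ; splitAt; _↑ˡ_; _↑ʳ_)
import Data.Fin.Properties as FP
open import Data.Fin.Induction using (<-weakInduction)
open import Data.Vec using (lookup; tabulate)
open import Data.Vec.Properties using (lookup∘tabulate; tabulate∘lookup; tabulate-cong)
open import Data.Sum using (_⊎_; inj₁; inj₂; [_,_]′)
open import Data.Product using (_×_; Σ-syntax; ∃; _,_; proj₁; proj₂)
open import Data.Empty using (⊥-elim)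
open import Function using (_∘_)
open import Relation.Nullary using (¬_; Dec; yes; no)
open import Relation.Nullary.Decidable using (_×-dec_; ¬?)
open import Relation.Binary.PropositionalEquality
open import Relation.Binary.Definitions using (tri<; tri≈; tri>)

private
  variable
    n : ℕ

-- Words as permutations

lookup-· : (a b : Word n) (i : Fin n) → lookup (a · b) i ≡ lookup a (lookup b i)
lookup-· a b = lookup∘tabulate _

lookup-one : (i : Fin n) → lookup (one n) i ≡ i
lookup-one = lookup∘tabulate _

lookup-gen : ∀ j (i : Fin n) → lookup (gen n j) i ≡ swapAdj j i
lookup-gen j = lookup∘tabulate _

lookup-gen-· : ∀ j (v : Word n) (i : Fin n) → lookup (gen n j · v) i ≡ swapAdj j (lookup v i)
lookup-gen-· j v i = trans (lookup-· (gen _ j) v i) (lookup-gen j (lookup v i))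

lookup-castW : ∀ {m} (eq : n ≡ m) (w : Word n) (i : Fin m) →
               toℕ (lookup (castW eq w) i) ≡ toℕ (lookup w (F.cast (sym eq) i))
lookup-castW eq w i = trans (cong toℕ (lookup∘tabulate _ i)) (FP.toℕ-cast _ _)

lookup-castW-tabulate : ∀ {m} (eq : n ≡ m) (f : Fin n → Fin n) (i : Fin m) →
                        toℕ (lookup (castW eq (tabulate f)) i) ≡ toℕ (f (F.cast (sym eq) i))
lookup-castW-tabulate eq f i = trans (lookup-castW eq (tabulate f) i) (cong toℕ (lookup∘tabulate f _))

Word-ext : {v w : Word n} → (∀ i → lookup v i ≡ lookup w i) → v ≡ w
Word-ext {v = v} {w} v≗w = begin
  v                    ≡⟨ tabulate∘lookup v ⟨
  tabulate (lookup v)  ≡⟨ tabulate-cong v≗w ⟩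
  tabulate (lookup w)  ≡⟨ tabulate∘lookup w ⟩
  w                    ∎
  where open ≡-Reasoning

·-assoc : (a b c : Word n) → a · (b · c) ≡ (a · b) · c
·-assoc a b c = Word-ext λ i → begin
  lookup (a · (b · c)) i            ≡⟨ lookup-· a (b · c) i ⟩
  lookup a (lookup (b · c) i)       ≡⟨ cong (lookup a) (lookup-· b c i) ⟩
  lookup a (lookup b (lookup c i))  ≡⟨ lookup-· a b (lookup c i) ⟨
  lookup (a · b) (lookup c i)       ≡⟨ lookup-· (a · b) c i ⟨
  lookup ((a · b) · c) i            ∎
  where open ≡-Reasoning

·-identityˡ : (w : Word n) → one n · w ≡ w
·-identityˡ w = Word-ext λ i → trans (lookup-· (one _) w i) (lookup-one (lookup w i))

·-identityʳ : (w : Word n) → w · one n ≡ w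
·-identityʳ w = Word-ext λ i → trans (lookup-· w (one _) i) (cong (lookup w) (lookup-one i))

swapAdj-involutive : ∀ j (k : Fin n) → swapAdj j (swapAdj j k) ≡ k
swapAdj-involutive {suc (suc n)} zero    zero          = refl
swapAdj-involutive {suc (suc n)} zero    (suc zero)    = refl
swapAdj-involutive {suc (suc n)} zero    (suc (suc k)) = refl
swapAdj-involutive {suc zero}    zero    zero          = refl
swapAdj-involutive {suc (suc n)} (suc j) zero          = refl
swapAdj-involutive {suc (suc n)} (suc j) (suc k)       = cong suc (swapAdj-involutive j k)
swapAdj-involutive {suc zero}    (suc j) zero          = refl

gen-·-gen : ∀ j (w : Word n) → gen n j · (gen n j · w) ≡ w
gen-·-gen j w = Word-ext λ i → begin
  lookup (gen _ j · (gen _ j · w)) i  ≡⟨ lookup-gen-· j (gen _ j · w) i ⟩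
  swapAdj j (lookup (gen _ j · w) i)  ≡⟨ cong (swapAdj j) (lookup-gen-· j w i) ⟩
  swapAdj j (swapAdj j (lookup w i))  ≡⟨ swapAdj-involutive j _ ⟩
  lookup w i                          ∎
  where open ≡-Reasoning

IsPerm-· : (a b : Word n) → IsPerm a → IsPerm b → IsPerm (a · b)
IsPerm-· a b pa pb i j e =
  pb i j (pa _ _ (trans (sym (lookup-· a b i)) (trans e (lookup-· a b j))))

IsPerm-one : IsPerm (one n)
IsPerm-one i k e = trans (sym (lookup-one i)) (trans e (lookup-one k))

IsPerm-gen : ∀ j → IsPerm (gen n j)
IsPerm-gen j i k e = begin
  i                        ≡⟨ swapAdj-involutive j i ⟨
  swapAdj j (swapAdj j i)  ≡⟨ cong (swapAdj j) (trans (sym (lookup-gen j i)) (trans e (lookup-gen j k))) ⟩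
  swapAdj j (swapAdj j k)  ≡⟨ swapAdj-involutive j k ⟩
  k                        ∎
  where open ≡-Reasoning

Prod⇒IsPerm : ∀ {k w} → Prod n k w → IsPerm w
Prod⇒IsPerm ε                    = IsPerm-one
Prod⇒IsPerm (cons {w = w} j _ p) = IsPerm-· (gen _ j) w (IsPerm-gen j) (Prod⇒IsPerm p)

-- If k were missed, punching it out would inject Fin (suc m) into Fin m.
injective⇒surjective : (f : Fin n → Fin n) → (∀ i j → f i ≡ f j → i ≡ j) →
                       ∀ k → Σ[ i ∈ Fin n ] f i ≡ k
injective⇒surjective {suc m} f inj k with FP.any? (λ i → f i F.≟ k)
... | yes found = found
... | no missed =
  let i , j , i<j , e = FP.pigeonhole (n<1+n m) (λ i → F.punchOut (k≢f i))
  in ⊥-elim (FP.<⇒≢ i<j (inj i j (FP.punchOut-injective (k≢f i) (k≢f j) e)))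
  where
  k≢f : ∀ i → k ≢ f i
  k≢f i e = missed (i , sym e)

inverse : (w : Word n) → IsPerm w → Word n
inverse w pw = tabulate (λ k → proj₁ (injective⇒surjective (lookup w) pw k))

lookup-inverseʳ : (w : Word n) (pw : IsPerm w) (k : Fin n) → lookup w (lookup (inverse w pw) k) ≡ k
lookup-inverseʳ w pw k =
  trans (cong (lookup w) (lookup∘tabulate _ k)) (proj₂ (injective⇒surjective (lookup w) pw k))

lookup-inverseˡ : (w : Word n) (pw : IsPerm w) (i : Fin n) → lookup (inverse w pw) (lookup w i) ≡ i
lookup-inverseˡ w pw i = pw _ _ (lookup-inverseʳ w pw (lookup w i))

·-inverseʳ : (w : Word n) (pw : IsPerm w) → w · inverse w pw ≡ one n
·-inverseʳ w pw = Word-ext λ k →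
  trans (lookup-· w (inverse w pw) k) (trans (lookup-inverseʳ w pw k) (sym (lookup-one k)))

·-inverseˡ : (w : Word n) (pw : IsPerm w) → inverse w pw · w ≡ one n
·-inverseˡ w pw = Word-ext λ k →
  trans (lookup-· (inverse w pw) w k) (trans (lookup-inverseˡ w pw k) (sym (lookup-one k)))

IsPerm-inverse : (w : Word n) (pw : IsPerm w) → IsPerm (inverse w pw)
IsPerm-inverse w pw i j e =
  trans (sym (lookup-inverseʳ w pw i)) (trans (cong (lookup w) e) (lookup-inverseʳ w pw j))

·-cancelʳ : {a b : Word n} (x : Word n) → IsPerm x → a · x ≡ b · x → a ≡ b
·-cancelʳ {n} {a} {b} x px ax≡bx = begin
  a                       ≡⟨ ·-identityʳ a ⟨
  a · one n               ≡⟨ cong (a ·_) (·-inverseʳ x px) ⟨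
  a · (x · x⁻¹)           ≡⟨ ·-assoc a x x⁻¹ ⟩
  (a · x) · x⁻¹           ≡⟨ cong (_· x⁻¹) ax≡bx ⟩
  (b · x) · x⁻¹           ≡⟨ ·-assoc b x x⁻¹ ⟨
  b · (x · x⁻¹)           ≡⟨ cong (b ·_) (·-inverseʳ x px) ⟩
  b · one n               ≡⟨ ·-identityʳ b ⟩
  b                       ∎
  where
  open ≡-Reasoning
  x⁻¹ : Word n
  x⁻¹ = inverse x px

dominant⇒maximal : (π : Word n) → IsPerm π → ∀ i₀ →
                   (∀ k → k ≢ i₀ → toℕ (lookup π k) < toℕ (lookup π i₀)) → suc (toℕ (lookup π i₀)) ≡ n
dominant⇒maximal {suc n} π pπ i₀ dominant
  with k , πk≡n ← injective⇒surjective (lookup π) pπ (F.fromℕ n) | k FP.≟ i₀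
... | yes refl = cong suc (trans (cong toℕ πk≡n) (FP.toℕ-fromℕ n))
... | no k≢i₀  = ⊥-elim (<⇒≱ (FP.toℕ<n (lookup π i₀))
                   (subst (λ m → suc m ≤ toℕ (lookup π i₀)) (trans (cong toℕ πk≡n) (FP.toℕ-fromℕ n))
                          (dominant k k≢i₀)))

maximal⇒dominant : (π : Word n) → IsPerm π → ∀ i₀ → suc (toℕ (lookup π i₀)) ≡ n →
                   ∀ k → k ≢ i₀ → toℕ (lookup π k) < toℕ (lookup π i₀)
maximal⇒dominant π pπ i₀ maximal k k≢i₀ =
  ≤∧≢⇒< (≤-pred (subst (suc (toℕ (lookup π k)) ≤_) (sym maximal) (FP.toℕ<n _)))
        (λ πk≡πi₀ → k≢i₀ (pπ k i₀ (FP.toℕ-injective πk≡πi₀)))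

SumEq-·ʳ : (x : Word n) → IsPerm x → (A B : Word n → Set) →
           (∀ ω → IsPerm ω → A ω → B (ω · x)) →
           (∀ π → IsPerm π → B π → Σ[ ω ∈ Word n ] IsPerm ω × A ω × ω · x ≡ π) →
           SumEq n A (_· x) B
SumEq-·ʳ x px A B forward backward π pπ =
  (λ Bπ → let ω , pω , Aω , ωx≡π = backward π pπ Bπ in
          ω , (pω , Aω , ωx≡π) , λ ω′ _ _ ω′x≡π → ·-cancelʳ x px (trans ω′x≡π (sym ωx≡π))) ,
  (λ ¬Bπ ω pω Aω ωx≡π → ¬Bπ (subst B ωx≡π (forward ω pω Aω)))

-- Inversions

swapAdj-lower : ∀ j (k : Fin n) → suc j < n → toℕ k ≡ j → toℕ (swapAdj j k) ≡ suc j
swapAdj-lower {suc (suc n)} zero    zero    _         refl = refl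
swapAdj-lower {suc zero}    zero    zero    (s<s ())  refl
swapAdj-lower {suc (suc n)} (suc j) (suc k) (s<s lt)  e    = cong suc (swapAdj-lower j k lt (suc-injective e))

swapAdj-upper : ∀ j (k : Fin n) → toℕ k ≡ suc j → toℕ (swapAdj j k) ≡ j
swapAdj-upper {suc (suc n)} zero    (suc zero) refl = refl
swapAdj-upper {suc (suc n)} (suc j) (suc k)    e    = cong suc (swapAdj-upper j k (suc-injective e))

swapAdj-other : ∀ j (k : Fin n) → toℕ k ≢ j → toℕ k ≢ suc j → swapAdj j k ≡ k
swapAdj-other {suc (suc n)} zero    zero          k≢j _   = ⊥-elim (k≢j refl)
swapAdj-other {suc (suc n)} zero    (suc zero)    _   k≢1 = ⊥-elim (k≢1 refl)
swapAdj-other {suc (suc n)} zero    (suc (suc k)) _   _   = refl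
swapAdj-other {suc zero}    zero    zero          _   _   = refl
swapAdj-other {suc (suc n)} (suc j) zero          _   _   = refl
swapAdj-other {suc (suc n)} (suc j) (suc k)       k≢j k≢sj =
  cong suc (swapAdj-other j k (k≢j ∘ cong suc) (k≢sj ∘ cong suc))
swapAdj-other {suc zero}    (suc j) zero          _   _   = refl

ExchangedBy : ℕ → ℕ → ℕ → Set
ExchangedBy j x y = (x ≡ j × y ≡ suc j) ⊎ (x ≡ suc j × y ≡ j)

ExchangedBy-sym : ∀ {j x y} → ExchangedBy j x y → ExchangedBy j y x
ExchangedBy-sym (inj₁ (x≡j , y≡sj)) = inj₂ (y≡sj , x≡j)
ExchangedBy-sym (inj₂ (x≡sj , y≡j)) = inj₁ (y≡j , x≡sj)

swapAdj-mono : ∀ j (x y : Fin n) → suc j < n → ¬ ExchangedBy j (toℕ x) (toℕ y) →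
               toℕ x < toℕ y → toℕ (swapAdj j x) < toℕ (swapAdj j y)
swapAdj-mono j x y lt ¬ex x<y with toℕ x ≟ j | toℕ x ≟ suc j | toℕ y ≟ j | toℕ y ≟ suc j
... | yes x≡j | _        | yes y≡j | _ = ⊥-elim (<-irrefl (trans x≡j (sym y≡j)) x<y)
... | yes x≡j | _        | no _    | yes y≡sj = ⊥-elim (¬ex (inj₁ (x≡j , y≡sj)))
... | yes x≡j | _        | no y≢j  | no y≢sj
  rewrite swapAdj-lower j x lt x≡j | swapAdj-other j y y≢j y≢sj = ≤∧≢⇒< (subst (_< toℕ y) x≡j x<y) (y≢sj ∘ sym)
... | no _    | yes x≡sj | yes y≡j | _ = ⊥-elim (¬ex (inj₂ (x≡sj , y≡j)))
... | no _    | yes x≡sj | no _    | yes y≡sj = ⊥-elim (<-irrefl (trans x≡sj (sym y≡sj)) x<y)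
... | no _    | yes x≡sj | no y≢j  | no y≢sj
  rewrite swapAdj-upper j x x≡sj | swapAdj-other j y y≢j y≢sj = <-trans (n<1+n j) (subst (_< toℕ y) x≡sj x<y)
... | no x≢j  | no x≢sj  | yes y≡j | _
  rewrite swapAdj-lower j y lt y≡j | swapAdj-other j x x≢j x≢sj = <-trans (subst (toℕ x <_) y≡j x<y) (n<1+n j)
... | no x≢j  | no x≢sj  | no _    | yes y≡sj
  rewrite swapAdj-upper j y y≡sj | swapAdj-other j x x≢j x≢sj = ≤∧≢⇒< (≤-pred (subst (toℕ x <_) y≡sj x<y)) x≢j
... | no x≢j  | no x≢sj  | no y≢j  | no y≢sj
  rewrite swapAdj-other j x x≢j x≢sj | swapAdj-other j y y≢j y≢sj = x<y

swapAdj-cancel-< : ∀ j (x y : Fin n) → suc j < n → ¬ ExchangedBy j (toℕ x) (toℕ y) →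
                   toℕ (swapAdj j x) < toℕ (swapAdj j y) → toℕ x < toℕ y
swapAdj-cancel-< j x y lt ¬ex sx<sy with <-cmp (toℕ x) (toℕ y)
... | tri< x<y _ _ = x<y
... | tri≈ _ x≡y _ = ⊥-elim (<-irrefl (cong (toℕ ∘ swapAdj j) (FP.toℕ-injective x≡y)) sx<sy)
... | tri> _ _ y<x = ⊥-elim (<-asym sx<sy (swapAdj-mono j y x lt (¬ex ∘ ExchangedBy-sym) y<x))

Inversion : Word n → Fin n → Fin n → Set
Inversion w i k = toℕ i < toℕ k × toℕ (lookup w k) < toℕ (lookup w i)

inversion? : (w : Word n) (i k : Fin n) → Dec (Inversion w i k)
inversion? w i k = (toℕ i <? toℕ k) ×-dec (toℕ (lookup w k) <? toℕ (lookup w i))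

infix 4 _⊆ᵢ_
_⊆ᵢ_ : Word n → Word n → Set
v ⊆ᵢ w = ∀ i k → Inversion v i k → Inversion w i k

Inversion-one : (i k : Fin n) → ¬ Inversion (one n) i k
Inversion-one i k (i<k , k<i) =
  <-asym i<k (subst₂ _<_ (cong toℕ (lookup-one k)) (cong toℕ (lookup-one i)) k<i)

one-⊆ᵢ : (w : Word n) → one n ⊆ᵢ w
one-⊆ᵢ w i k inv = ⊥-elim (Inversion-one i k inv)

module _ (v : Word n) (j : ℕ) (lt : suc j < n) (i k : Fin n)
         (¬ex : ¬ ExchangedBy j (toℕ (lookup v k)) (toℕ (lookup v i))) where

  gen-·-inversion⁺ : Inversion v i k → Inversion (gen n j · v) i k
  gen-·-inversion⁺ (i<k , vk<vi) =
    i<k , subst₂ _<_ (cong toℕ (sym (lookup-gen-· j v k))) (cong toℕ (sym (lookup-gen-· j v i)))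
                     (swapAdj-mono j _ _ lt ¬ex vk<vi)

  gen-·-inversion⁻ : Inversion (gen n j · v) i k → Inversion v i k
  gen-·-inversion⁻ (i<k , svk<svi) =
    i<k , swapAdj-cancel-< j _ _ lt ¬ex
            (subst₂ _<_ (cong toℕ (lookup-gen-· j v k)) (cong toℕ (lookup-gen-· j v i)) svk<svi)

∑ : (Fin n → ℕ) → ℕ
∑ {zero}  f = 0
∑ {suc n} f = f zero + ∑ (f ∘ suc)

∑-cong : {f g : Fin n → ℕ} → (∀ i → f i ≡ g i) → ∑ f ≡ ∑ g
∑-cong {zero}  f≗g = refl
∑-cong {suc n} f≗g = cong₂ _+_ (f≗g zero) (∑-cong (f≗g ∘ suc))

∑-zero : {f : Fin n → ℕ} → (∀ i → f i ≡ 0) → ∑ f ≡ 0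
∑-zero {zero}  f≗0 = refl
∑-zero {suc n} f≗0 = cong₂ _+_ (f≗0 zero) (∑-zero (f≗0 ∘ suc))

∑-suc-at : {f g : Fin n → ℕ} (i₀ : Fin n) → f i₀ ≡ suc (g i₀) → (∀ i → i ≢ i₀ → f i ≡ g i) →
           ∑ f ≡ suc (∑ g)
∑-suc-at {suc n} zero     e f≗g = cong₂ _+_ e (∑-cong λ i → f≗g (suc i) λ ())
∑-suc-at {suc n} {g = g} (suc i₀) e f≗g =
  trans (cong₂ _+_ (f≗g zero λ ()) (∑-suc-at i₀ e λ i i≢i₀ → f≗g (suc i) (i≢i₀ ∘ FP.suc-injective)))
        (+-suc (g zero) _)

𝟙 : {A : Set} → Dec A → ℕ
𝟙 (yes _) = 1
𝟙 (no _)  = 0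

𝟙-cong : {A B : Set} (a? : Dec A) (b? : Dec B) → (A → B) → (B → A) → 𝟙 a? ≡ 𝟙 b?
𝟙-cong (yes _) (yes _) _   _   = refl
𝟙-cong (yes a) (no ¬b) a→b _   = ⊥-elim (¬b (a→b a))
𝟙-cong (no ¬a) (yes b) _   b→a = ⊥-elim (¬a (b→a b))
𝟙-cong (no _)  (no _)  _   _   = refl

𝟙-yes : {A : Set} (a? : Dec A) → A → 𝟙 a? ≡ 1
𝟙-yes (yes _) _ = refl
𝟙-yes (no ¬a) a = ⊥-elim (¬a a)

𝟙-no : {A : Set} (a? : Dec A) → ¬ A → 𝟙 a? ≡ 0
𝟙-no (yes a) ¬a = ⊥-elim (¬a a)
𝟙-no (no _)  _  = refl

invCount : Word n → ℕ
invCount w = ∑ λ i → ∑ λ k → 𝟙 (inversion? w i k)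

invCount-one : ∀ n → invCount (one n) ≡ 0
invCount-one n = ∑-zero λ i → ∑-zero λ k → 𝟙-no (inversion? (one n) i k) (Inversion-one i k)

module AdjacentSwap (v : Word n) (pv : IsPerm v) (j : ℕ) (lt : suc j < n) (a b : Fin n)
                    (va : toℕ (lookup v a) ≡ j) (vb : toℕ (lookup v b) ≡ suc j) where

  sv : Word n
  sv = gen n j · v

  sva : toℕ (lookup sv a) ≡ suc j
  sva = trans (cong toℕ (lookup-gen-· j v a)) (swapAdj-lower j _ lt va)

  svb : toℕ (lookup sv b) ≡ j
  svb = trans (cong toℕ (lookup-gen-· j v b)) (swapAdj-upper j _ vb)

  private
    samePosition : ∀ {m c x} → toℕ (lookup v m) ≡ x → toℕ (lookup v c) ≡ x → m ≡ c
    samePosition e e′ = pv _ _ (FP.toℕ-injective (trans e (sym e′)))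

  ¬ExchangedBy-elsewhere : ∀ i k → ¬ (i ≡ a × k ≡ b) → ¬ (i ≡ b × k ≡ a) →
                           ¬ ExchangedBy j (toℕ (lookup v k)) (toℕ (lookup v i))
  ¬ExchangedBy-elsewhere i k ≢ab ≢ba (inj₁ (vk≡j , vi≡sj)) = ≢ba (samePosition vi≡sj vb , samePosition vk≡j va)
  ¬ExchangedBy-elsewhere i k ≢ab ≢ba (inj₂ (vk≡sj , vi≡j)) = ≢ab (samePosition vi≡j va , samePosition vk≡sj vb)

  𝟙-inversion-elsewhere : ∀ i k → ¬ (i ≡ a × k ≡ b) → ¬ (i ≡ b × k ≡ a) →
                          𝟙 (inversion? sv i k) ≡ 𝟙 (inversion? v i k)
  𝟙-inversion-elsewhere i k ≢ab ≢ba = 𝟙-cong (inversion? sv i k) (inversion? v i k)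
    (gen-·-inversion⁻ v j lt i k ¬ex) (gen-·-inversion⁺ v j lt i k ¬ex)
    where
    ¬ex : ¬ ExchangedBy j (toℕ (lookup v k)) (toℕ (lookup v i))
    ¬ex = ¬ExchangedBy-elsewhere i k ≢ab ≢ba

  a≢b : toℕ a ≢ toℕ b
  a≢b a≡b = 1+n≢n (trans (sym vb) (trans (cong (toℕ ∘ lookup v) (sym (FP.toℕ-injective a≡b))) va))

  module Ascent (a<b : toℕ a < toℕ b) where

    invCount-ascent : invCount sv ≡ suc (invCount v)
    invCount-ascent = ∑-suc-at a row-a other-rows
      where
      row-a : ∑ (λ k → 𝟙 (inversion? sv a k)) ≡ suc (∑ λ k → 𝟙 (inversion? v a k))
      row-a = ∑-suc-at b
        (trans (𝟙-yes (inversion? sv a b) (a<b , subst₂ _<_ (sym svb) (sym sva) (n<1+n j)))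
               (cong suc (sym (𝟙-no (inversion? v a b)
                 λ (_ , vb<va) → <-asym vb<va (subst₂ _<_ (sym va) (sym vb) (n<1+n j))))))
        (λ k k≢b → 𝟙-inversion-elsewhere a k (k≢b ∘ proj₂) λ (a≡b , _) → <-irrefl (cong toℕ a≡b) a<b)
      other-rows : ∀ i → i ≢ a → ∑ (λ k → 𝟙 (inversion? sv i k)) ≡ ∑ (λ k → 𝟙 (inversion? v i k))
      other-rows i i≢a = ∑-cong λ k → entry k (i FP.≟ b) (k FP.≟ a)
        where
        entry : ∀ k → Dec (i ≡ b) → Dec (k ≡ a) → 𝟙 (inversion? sv i k) ≡ 𝟙 (inversion? v i k)
        entry k (yes refl) (yes refl) =
          trans (𝟙-no (inversion? sv b a) (λ (b<a , _) → <-asym b<a a<b))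
                (sym (𝟙-no (inversion? v b a) (λ (b<a , _) → <-asym b<a a<b)))
        entry k (yes _)    (no k≢a)   = 𝟙-inversion-elsewhere i k (i≢a ∘ proj₁) (k≢a ∘ proj₂)
        entry k (no i≢b)   _          = 𝟙-inversion-elsewhere i k (i≢a ∘ proj₁) (i≢b ∘ proj₁)

    ⊆ᵢ-ascent : v ⊆ᵢ sv
    ⊆ᵢ-ascent i k inv with (i FP.≟ a) ×-dec (k FP.≟ b) | (i FP.≟ b) ×-dec (k FP.≟ a)
    ... | yes (refl , refl) | _ = ⊥-elim (<-asym (proj₂ inv) (subst₂ _<_ (sym va) (sym vb) (n<1+n j)))
    ... | no _ | yes (refl , refl) = ⊥-elim (<-asym (proj₁ inv) a<b)
    ... | no ≢ab | no ≢ba = gen-·-inversion⁺ v j lt i k (¬ExchangedBy-elsewhere i k ≢ab ≢ba) inv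

module AdjacentSwapDescent (v : Word n) (pv : IsPerm v) (j : ℕ) (lt : suc j < n) (a b : Fin n)
                           (va : toℕ (lookup v a) ≡ j) (vb : toℕ (lookup v b) ≡ suc j)
                           (b<a : toℕ b < toℕ a) where
  open AdjacentSwap v pv j lt a b va vb

  invCount-descent : invCount v ≡ suc (invCount sv)
  invCount-descent = trans (cong invCount (sym (gen-·-gen j v)))
    (AdjacentSwap.Ascent.invCount-ascent sv (IsPerm-· (gen n j) v (IsPerm-gen j) pv) j lt b a svb sva b<a)

  inversion-descent : ∀ i k → Inversion v i k → (i ≡ b × k ≡ a) ⊎ Inversion sv i k
  inversion-descent i k inv with (i FP.≟ a) ×-dec (k FP.≟ b) | (i FP.≟ b) ×-dec (k FP.≟ a)
  ... | yes (refl , refl) | _ = ⊥-elim (<-asym (proj₁ inv) b<a)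
  ... | no _ | yes ba = inj₁ ba
  ... | no ≢ab | no ≢ba = inj₂ (gen-·-inversion⁺ v j lt i k (¬ExchangedBy-elsewhere i k ≢ab ≢ba) inv)

valuePosition : (v : Word n) → IsPerm v → ∀ {c} → c < n → Σ[ a ∈ Fin n ] toℕ (lookup v a) ≡ c
valuePosition v pv c<n =
  lookup (inverse v pv) (F.fromℕ< c<n) ,
  trans (cong toℕ (lookup-inverseʳ v pv _)) (FP.toℕ-fromℕ< c<n)

gen-·-cases : (v : Word n) → IsPerm v → ∀ j → suc j < n →
              (invCount (gen n j · v) ≡ suc (invCount v) × v ⊆ᵢ gen n j · v) ⊎
              invCount v ≡ suc (invCount (gen n j · v))
gen-·-cases v pv j lt with valuePosition v pv (<-trans (n<1+n j) lt) | valuePosition v pv lt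
... | a , va | b , vb with <-cmp (toℕ a) (toℕ b)
...   | tri< a<b _ _ = inj₁ (invCount-ascent , ⊆ᵢ-ascent)
  where open AdjacentSwap.Ascent v pv j lt a b va vb a<b
...   | tri≈ _ a≡b _ = ⊥-elim (AdjacentSwap.a≢b v pv j lt a b va vb a≡b)
...   | tri> _ _ b<a = inj₂ (AdjacentSwapDescent.invCount-descent v pv j lt a b va vb b<a)

invCount-gen-·-≤ : (v : Word n) → IsPerm v → ∀ j → suc j < n → invCount (gen n j · v) ≤ suc (invCount v)
invCount-gen-·-≤ v pv j lt with gen-·-cases v pv j lt
... | inj₁ (ascent , _) = ≤-reflexive ascent
... | inj₂ descent = begin
  invCount (gen _ j · v)        ≤⟨ n≤1+n _ ⟩
  suc (invCount (gen _ j · v))  ≡⟨ descent ⟨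
  invCount v                    ≤⟨ n≤1+n _ ⟩
  suc (invCount v)              ∎
  where open ≤-Reasoning

invCount-gen-·-ascent⇒⊆ᵢ : (v : Word n) → IsPerm v → ∀ j → suc j < n →
                           invCount (gen n j · v) ≡ suc (invCount v) → v ⊆ᵢ gen n j · v
invCount-gen-·-ascent⇒⊆ᵢ v pv j lt ascent with gen-·-cases v pv j lt
... | inj₁ (_ , v⊆sv) = v⊆sv
... | inj₂ descent    = ⊥-elim (<-irrefl (trans descent (cong suc ascent)) (<-trans (n<1+n _) (n<1+n _)))

-- Length and the weak order

invCount-Prod-· : ∀ {k t} → Prod n k t → (w : Word n) → IsPerm w → invCount (t · w) ≤ invCount w + k
invCount-Prod-· ε w pw = ≤-reflexive (trans (cong invCount (·-identityˡ w)) (sym (+-identityʳ _)))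
invCount-Prod-· (cons {k} {t} j lt P) w pw = begin
  invCount ((gen _ j · t) · w)  ≡⟨ cong invCount (·-assoc (gen _ j) t w) ⟨
  invCount (gen _ j · (t · w))  ≤⟨ invCount-gen-·-≤ (t · w) (IsPerm-· t w (Prod⇒IsPerm P) pw) j lt ⟩
  suc (invCount (t · w))        ≤⟨ s≤s (invCount-Prod-· P w pw) ⟩
  suc (invCount w + k)          ≡⟨ +-suc (invCount w) k ⟨
  invCount w + suc k            ∎
  where open ≤-Reasoning

invCount≤Prod : ∀ {k w} → Prod n k w → invCount w ≤ k
invCount≤Prod {n} {k} {w} P =
  subst₂ _≤_ (cong invCount (·-identityʳ w)) (cong (_+ k) (invCount-one n)) (invCount-Prod-· P (one n) IsPerm-one)

-- Equality in the bound above forces every generator to create a new inversion.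
invCount-Prod-·-tight⇒⊆ᵢ : ∀ {k t} → Prod n k t → (w : Word n) → IsPerm w →
                           invCount (t · w) ≡ invCount w + k → w ⊆ᵢ t · w
invCount-Prod-·-tight⇒⊆ᵢ ε w pw _ = subst (w ⊆ᵢ_) (sym (·-identityˡ w)) (λ _ _ inv → inv)
invCount-Prod-·-tight⇒⊆ᵢ {n} (cons {k} {t} j lt P) w pw tight =
  subst (w ⊆ᵢ_) (·-assoc (gen n j) t w) λ i k inv → tw⊆stw i k (w⊆tw i k inv)
  where
  ptw : IsPerm (t · w)
  ptw = IsPerm-· t w (Prod⇒IsPerm P) pw
  tight′ : invCount (gen n j · (t · w)) ≡ suc (invCount w + k)
  tight′ = trans (trans (cong invCount (·-assoc (gen n j) t w)) tight) (+-suc (invCount w) k)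
  tight-t : invCount (t · w) ≡ invCount w + k
  tight-t = ≤-antisym (invCount-Prod-· P w pw)
    (≤-pred (≤-trans (≤-reflexive (sym tight′)) (invCount-gen-·-≤ (t · w) ptw j lt)))
  w⊆tw : w ⊆ᵢ t · w
  w⊆tw = invCount-Prod-·-tight⇒⊆ᵢ P w pw tight-t
  tw⊆stw : t · w ⊆ᵢ gen n j · (t · w)
  tw⊆stw = invCount-gen-·-ascent⇒⊆ᵢ (t · w) ptw j lt
             (trans tight′ (cong suc (sym tight-t)))

StrictlyIncreasing : (Fin n → Fin n) → Set
StrictlyIncreasing f = ∀ a b → toℕ a < toℕ b → toℕ (f a) < toℕ (f b)

increasing⇒inflationary : {f : Fin n → Fin n} → StrictlyIncreasing f → ∀ a → toℕ a ≤ toℕ (f a)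
increasing⇒inflationary {suc n} {f} inc = <-weakInduction (λ a → toℕ a ≤ toℕ (f a)) z≤n step
  where
  step : ∀ i → toℕ (F.inject₁ i) ≤ toℕ (f (F.inject₁ i)) → suc (toℕ i) ≤ toℕ (f (suc i))
  step i ih = begin
    suc (toℕ i)                   ≡⟨ cong suc (FP.toℕ-inject₁ i) ⟨
    suc (toℕ (F.inject₁ i))       ≤⟨ s≤s ih ⟩
    suc (toℕ (f (F.inject₁ i)))   ≤⟨ inc _ _ (s≤s (≤-reflexive (FP.toℕ-inject₁ i))) ⟩
    toℕ (f (suc i))               ∎
    where open ≤-Reasoning

-- With equal inversion sets π · w⁻¹ is strictly increasing, hence inflationary; by symmetry it is the identity.
private
  sameInversions⇒≤ : (π w : Word n) (pπ : IsPerm π) (pw : IsPerm w) → π ⊆ᵢ w → w ⊆ᵢ π →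
                     ∀ m → toℕ (lookup w m) ≤ toℕ (lookup π m)
  sameInversions⇒≤ π w pπ pw π⊆w w⊆π m =
    subst (toℕ (lookup w m) ≤_)
          (cong toℕ (trans (lookup-· π w⁻¹ (lookup w m)) (cong (lookup π) (lookup-inverseˡ w pw m))))
      (increasing⇒inflationary increasing (lookup w m))
    where
    w⁻¹ : Word _
    w⁻¹ = inverse w pw
    increasing : StrictlyIncreasing (lookup (π · w⁻¹))
    increasing c d c<d =
      subst₂ _<_ (cong toℕ (sym (lookup-· π w⁻¹ c))) (cong toℕ (sym (lookup-· π w⁻¹ d))) πi<πk
      where
      i k : Fin _
      i = lookup w⁻¹ c
      k = lookup w⁻¹ d
      wi<wk : toℕ (lookup w i) < toℕ (lookup w k)
      wi<wk = subst₂ _<_ (cong toℕ (sym (lookup-inverseʳ w pw c))) (cong toℕ (sym (lookup-inverseʳ w pw d))) c<d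
      πi<πk : toℕ (lookup π i) < toℕ (lookup π k)
      πi<πk with <-cmp (toℕ i) (toℕ k) | <-cmp (toℕ (lookup π i)) (toℕ (lookup π k))
      ... | _            | tri< πi<πk _ _ = πi<πk
      ... | _            | tri≈ _ πi≡πk _ =
        ⊥-elim (<-irrefl (cong (toℕ ∘ lookup w) (pπ i k (FP.toℕ-injective πi≡πk))) wi<wk)
      ... | tri< i<k _ _ | tri> _ _ πk<πi = ⊥-elim (<-asym wi<wk (proj₂ (π⊆w i k (i<k , πk<πi))))
      ... | tri≈ _ i≡k _ | tri> _ _ πk<πi =
        ⊥-elim (<-irrefl (cong (toℕ ∘ lookup π) (FP.toℕ-injective (sym i≡k))) πk<πi)
      ... | tri> _ _ k<i | tri> _ _ _     = proj₂ (w⊆π k i (k<i , wi<wk))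

⊆ᵢ-antisym : (π w : Word n) → IsPerm π → IsPerm w → π ⊆ᵢ w → w ⊆ᵢ π → π ≡ w
⊆ᵢ-antisym π w pπ pw π⊆w w⊆π = Word-ext λ i → FP.toℕ-injective
  (≤-antisym (sameInversions⇒≤ w π pw pπ w⊆π π⊆w i) (sameInversions⇒≤ π w pπ pw π⊆w w⊆π i))

decrease⇒descent : (G : ℕ → ℕ) → ∀ {lo hi} → lo ≤ hi → G hi < G lo → Σ[ c ∈ ℕ ] c < hi × G (suc c) < G c
decrease⇒descent G lo≤hi = go (≤⇒≤′ lo≤hi)
  where
  go : ∀ {lo hi} → lo ≤′ hi → G hi < G lo → Σ[ c ∈ ℕ ] c < hi × G (suc c) < G c
  go ≤′-refl               G[lo]<G[lo]   = ⊥-elim (<-irrefl refl G[lo]<G[lo])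
  go (≤′-step {hi} lo≤′hi) G[1+hi]<G[lo] with G (suc hi) <? G hi
  ... | yes drop = hi , n<1+n hi , drop
  ... | no ¬drop =
    let c , c<hi , drop = go lo≤′hi (≤-<-trans (≮⇒≥ ¬drop) G[1+hi]<G[lo]) in c , m<n⇒m<1+n c<hi , drop

record DescentOutside (w π : Word n) : Set where
  field
    j     : ℕ
    j+1<n : suc j < n
    a b   : Fin n
    πa    : toℕ (lookup π a) ≡ j
    πb    : toℕ (lookup π b) ≡ suc j
    b<a   : toℕ b < toℕ a
    ¬wba  : ¬ Inversion w b a

module _ (w π : Word n) (pw : IsPerm w) (pπ : IsPerm π) (i k : Fin n) where

  private
    -- junk value i when c ≥ n; only values below n are ever looked up
    position : ℕ → Fin n
    position c with c <? n
    ... | yes c<n = proj₁ (valuePosition π pπ c<n)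
    ... | no _    = i

    position-value : ∀ c → c < n → toℕ (lookup π (position c)) ≡ c
    position-value c c<n with c <? n
    ... | yes c<n′ = proj₂ (valuePosition π pπ c<n′)
    ... | no c≮n   = ⊥-elim (c≮n c<n)

    position-π : ∀ m → position (toℕ (lookup π m)) ≡ m
    position-π m = pπ _ m (FP.toℕ-injective (position-value _ (FP.toℕ<n _)))

    G : ℕ → ℕ
    G c = toℕ (lookup w (position c))

    G-decreases : toℕ i < toℕ k → ¬ Inversion w i k → G (toℕ (lookup π i)) < G (toℕ (lookup π k))
    G-decreases i<k ¬wik rewrite position-π i | position-π k with <-cmp (toℕ (lookup w i)) (toℕ (lookup w k))
    ... | tri< wi<wk _ _ = wi<wk
    ... | tri≈ _ wi≡wk _ = ⊥-elim (<-irrefl (cong toℕ (pw i k (FP.toℕ-injective wi≡wk))) i<k)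
    ... | tri> _ _ wk<wi = ⊥-elim (¬wik (i<k , wk<wi))

  -- Along the values π k < … < π i, G = w ∘ π⁻¹ goes from w k down to w i, so it drops at some
  -- adjacent pair of values.
  inversionOutside⇒descent : w ⊆ᵢ π → Inversion π i k → ¬ Inversion w i k → DescentOutside w π
  inversionOutside⇒descent w⊆π (i<k , πk<πi) ¬wik with decrease⇒descent G (<⇒≤ πk<πi) (G-decreases i<k ¬wik)
  ... | c , c<πi , Gc+1<Gc = record
    { j = c ; j+1<n = c+1<n ; a = position c ; b = position (suc c)
    ; πa = position-value c c<n ; πb = position-value (suc c) c+1<n ; b<a = b<a
    ; ¬wba = λ (_ , wa<wb) → <-asym Gc+1<Gc wa<wb }
    where
    c+1<n : suc c < n
    c+1<n = ≤-<-trans c<πi (FP.toℕ<n (lookup π i))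
    c<n : c < n
    c<n = <-trans (n<1+n c) c+1<n
    b<a : toℕ (position (suc c)) < toℕ (position c)
    b<a with <-cmp (toℕ (position (suc c))) (toℕ (position c))
    ... | tri< b<a _ _ = b<a
    ... | tri≈ _ b≡a _ = ⊥-elim (1+n≢n (trans (sym (position-value (suc c) c+1<n))
                           (trans (cong (toℕ ∘ lookup π) (FP.toℕ-injective b≡a)) (position-value c c<n))))
    ... | tri> _ _ a<b = ⊥-elim (<-asym (n<1+n c) (subst₂ _<_ (position-value (suc c) c+1<n) (position-value c c<n)
                           (proj₂ (w⊆π _ _ (a<b , Gc+1<Gc)))))

Factorization : Word n → Word n → Set
Factorization {n} w π = Σ[ k ∈ ℕ ] Σ[ t ∈ Word n ] Prod n k t × t · w ≡ π × invCount π ≡ invCount w + k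

module _ (w : Word n) (pw : IsPerm w) where

  private
    extraInversion? : (π : Word n) → Dec (∃ λ i → ∃ λ k → Inversion π i k × ¬ Inversion w i k)
    extraInversion? π = FP.any? λ i → FP.any? λ k → inversion? π i k ×-dec ¬? (inversion? w i k)

    factorization-gen : ∀ {π} j → suc j < n → invCount π ≡ suc (invCount (gen n j · π)) →
                        Factorization w (gen n j · π) → Factorization w π
    factorization-gen {π} j lt descent (k , t , P , tw≡sπ , count) =
      suc k , gen n j · t , cons j lt P ,
      trans (sym (·-assoc (gen n j) t w)) (trans (cong (gen n j ·_) tw≡sπ) (gen-·-gen j π)) ,
      trans descent (trans (cong suc count) (sym (+-suc (invCount w) k)))

  ⊆ᵢ⇒factorization : ∀ m (π : Word n) → IsPerm π → invCount π ≡ m → w ⊆ᵢ π → Factorization w π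
  ⊆ᵢ⇒factorization m π pπ count w⊆π with extraInversion? π
  ... | no none = 0 , one n , ε , trans (·-identityˡ w) (sym π≡w) , trans (cong invCount π≡w) (sym (+-identityʳ _))
    where
    π⊆w : π ⊆ᵢ w
    π⊆w i k inv with inversion? w i k
    ... | yes winv = winv
    ... | no ¬winv = ⊥-elim (none (i , k , inv , ¬winv))
    π≡w : π ≡ w
    π≡w = ⊆ᵢ-antisym π w pπ pw π⊆w w⊆π
  ... | yes (i , k , πik , ¬wik) = factorization-gen j j+1<n descent (recurse m count)
    where
    open DescentOutside (inversionOutside⇒descent w π pw pπ i k w⊆π πik ¬wik)
    open AdjacentSwapDescent π pπ j j+1<n a b πa πb b<a
    descent : invCount π ≡ suc (invCount (gen n j · π))
    descent = invCount-descent
    w⊆sπ : w ⊆ᵢ gen n j · π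
    w⊆sπ i k winv with inversion-descent i k (w⊆π i k winv)
    ... | inj₁ (refl , refl) = ⊥-elim (¬wba winv)
    ... | inj₂ sπinv         = sπinv
    recurse : ∀ m → invCount π ≡ m → Factorization w (gen n j · π)
    recurse zero    count = ⊥-elim (1+n≢0 (trans (sym descent) count))
    recurse (suc m) count = ⊆ᵢ⇒factorization m (gen n j · π) (IsPerm-· (gen n j) π (IsPerm-gen j) pπ)
                              (suc-injective (trans (sym descent) count)) w⊆sπ

Prod-invCount : (w : Word n) → IsPerm w → Prod n (invCount w) w
Prod-invCount {n} w pw with ⊆ᵢ⇒factorization (one n) IsPerm-one (invCount w) w pw refl (one-⊆ᵢ w)
... | k , t , P , t1≡w , count =
  subst₂ (Prod n) (sym (trans count (cong (_+ k) (invCount-one n)))) (trans (sym (·-identityʳ t)) t1≡w) P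

HasLength-invCount : (w : Word n) → IsPerm w → HasLength w (invCount w)
HasLength-invCount w pw = Prod-invCount w pw , λ j j<count P → <⇒≱ j<count (invCount≤Prod P)

HasLength⇒≡invCount : (w : Word n) → IsPerm w → ∀ {l} → HasLength w l → l ≡ invCount w
HasLength⇒≡invCount w pw {l} (P , minimal) with <-cmp l (invCount w)
... | tri< l<count _ _ = ⊥-elim (<⇒≱ l<count (invCount≤Prod P))
... | tri≈ _ l≡count _ = l≡count
... | tri> _ _ count<l = ⊥-elim (minimal (invCount w) count<l (Prod-invCount w pw))

≤w⇒⊆ᵢ : (ω π : Word n) → IsPerm ω → ω ≤w π → ω ⊆ᵢ π
≤w⇒⊆ᵢ ω π pω (t , pt , π≡tω , a , b , lt , lω , lπ) =
  subst (ω ⊆ᵢ_) (sym π≡tω) (invCount-Prod-·-tight⇒⊆ᵢ (proj₁ lt) ω pω tight)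
  where
  tight : invCount (t · ω) ≡ invCount ω + a
  tight = begin
    invCount (t · ω)  ≡⟨ cong invCount π≡tω ⟨
    invCount π        ≡⟨ HasLength⇒≡invCount π (subst IsPerm (sym π≡tω) (IsPerm-· t ω pt pω)) lπ ⟨
    a + b             ≡⟨ +-comm a b ⟩
    b + a             ≡⟨ cong (_+ a) (HasLength⇒≡invCount ω pω lω) ⟩
    invCount ω + a    ∎
    where open ≡-Reasoning

⊆ᵢ⇒≤w : (ω π : Word n) → IsPerm ω → IsPerm π → ω ⊆ᵢ π → ω ≤w π
⊆ᵢ⇒≤w {n} ω π pω pπ ω⊆π with ⊆ᵢ⇒factorization ω pω (invCount π) π pπ refl ω⊆π
... | k , t , P , tω≡π , count =
  t , Prod⇒IsPerm P , sym tω≡π , k , invCount ω , (P , minimal) , HasLength-invCount ω pω ,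
  subst (HasLength π) (trans count (+-comm (invCount ω) k)) (HasLength-invCount π pπ)
  where
  minimal : ∀ j → j < k → ¬ Prod n j t
  minimal j j<k Q = <⇒≱ (+-monoʳ-< (invCount ω) j<k)
    (subst (_≤ invCount ω + j) (trans (cong invCount tω≡π) count) (invCount-Prod-· Q ω pω))

-- Blocks and shuffles

data BlockView (m k : ℕ) : Fin (m + k) → Set where
  inLeft  : (a : Fin m) → BlockView m k (a ↑ˡ k)
  inRight : (b : Fin k) → BlockView m k (m ↑ʳ b)

blockView : ∀ m k (i : Fin (m + k)) → BlockView m k i
blockView m k i with splitAt m i in eq
... | inj₁ a = subst (BlockView m k) (FP.splitAt⁻¹-↑ˡ eq) (inLeft a)
... | inj₂ b = subst (BlockView m k) (FP.splitAt⁻¹-↑ʳ eq) (inRight b)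

module _ {A : Set} {m k : ℕ} (f : Fin m → A) (g : Fin k → A) where

  lookup-tabulate-splitAt-↑ˡ : ∀ a → lookup (tabulate (λ i → [ f , g ]′ (splitAt m i))) (a ↑ˡ k) ≡ f a
  lookup-tabulate-splitAt-↑ˡ a rewrite lookup∘tabulate (λ i → [ f , g ]′ (splitAt m i)) (a ↑ˡ k)
                                      | FP.splitAt-↑ˡ m a k = refl

  lookup-tabulate-splitAt-↑ʳ : ∀ b → lookup (tabulate (λ i → [ f , g ]′ (splitAt m i))) (m ↑ʳ b) ≡ g b
  lookup-tabulate-splitAt-↑ʳ b rewrite lookup∘tabulate (λ i → [ f , g ]′ (splitAt m i)) (m ↑ʳ b)
                                      | FP.splitAt-↑ʳ m k b = refl

lookup-×ₚ-↑ˡ : ∀ {m k} (σ : Word m) (τ : Word k) a → lookup (σ ×ₚ τ) (a ↑ˡ k) ≡ lookup σ a ↑ˡ k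
lookup-×ₚ-↑ˡ {k = k} σ τ = lookup-tabulate-splitAt-↑ˡ (λ a → lookup σ a ↑ˡ k) (λ b → _ ↑ʳ lookup τ b)

lookup-×ₚ-↑ʳ : ∀ {m k} (σ : Word m) (τ : Word k) b → lookup (σ ×ₚ τ) (m ↑ʳ b) ≡ m ↑ʳ lookup τ b
lookup-×ₚ-↑ʳ {m} {k} σ τ = lookup-tabulate-splitAt-↑ʳ (λ a → lookup σ a ↑ˡ k) (λ b → m ↑ʳ lookup τ b)

private
  ξ-left : ∀ m k → Fin m → Fin (m + k)
  ξ-left m k a = F.cast (+-comm k m) (k ↑ʳ a)

  ξ-right : ∀ m k → Fin k → Fin (m + k)
  ξ-right m k b = F.cast (+-comm k m) (b ↑ˡ m)

toℕ-ξ-↑ˡ : ∀ m k (a : Fin m) → toℕ (lookup (ξ m k) (a ↑ˡ k)) ≡ k + toℕ a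
toℕ-ξ-↑ˡ m k a = trans (cong toℕ (lookup-tabulate-splitAt-↑ˡ (ξ-left m k) (ξ-right m k) a))
                        (trans (FP.toℕ-cast _ _) (FP.toℕ-↑ʳ k a))

toℕ-ξ-↑ʳ : ∀ m k (b : Fin k) → toℕ (lookup (ξ m k) (m ↑ʳ b)) ≡ toℕ b
toℕ-ξ-↑ʳ m k b = trans (cong toℕ (lookup-tabulate-splitAt-↑ʳ (ξ-left m k) (ξ-right m k) b))
                        (trans (FP.toℕ-cast _ _) (FP.toℕ-↑ˡ b m))

splitAt-graph : ∀ {m k N} (R : ℕ → ℕ → Set) (f : Fin m → Fin N) (g : Fin k → Fin N) →
                (∀ a → R (toℕ a) (toℕ (f a))) → (∀ b → R (m + toℕ b) (toℕ (g b))) →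
                ∀ i → R (toℕ i) (toℕ ([ f , g ]′ (splitAt m i)))
splitAt-graph {m} {k} R f g onLeft onRight i with splitAt m i in eq
... | inj₁ a =
  subst (λ j → R j (toℕ (f a))) (trans (sym (FP.toℕ-↑ˡ a k)) (cong toℕ (FP.splitAt⁻¹-↑ˡ eq))) (onLeft a)
... | inj₂ b =
  subst (λ j → R j (toℕ (g b))) (trans (sym (FP.toℕ-↑ʳ m b)) (cong toℕ (FP.splitAt⁻¹-↑ʳ eq))) (onRight b)

×ₚ-graph : ∀ {m k} (σ : Word m) (τ : Word k) (R : ℕ → ℕ → Set) →
           (∀ a → R (toℕ a) (toℕ (lookup σ a))) → (∀ b → R (m + toℕ b) (m + toℕ (lookup τ b))) →
           ∀ i → R (toℕ i) (toℕ (lookup (σ ×ₚ τ) i))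
×ₚ-graph {m} {k} σ τ R onLeft onRight i =
  subst (R (toℕ i)) (cong toℕ (sym (lookup∘tabulate _ i))) (splitAt-graph R _ _
    (λ a → subst (R (toℕ a)) (sym (FP.toℕ-↑ˡ (lookup σ a) k)) (onLeft a))
    (λ b → subst (R (m + toℕ b)) (sym (FP.toℕ-↑ʳ m (lookup τ b))) (onRight b)) i)

ξ-graph : ∀ m k (R : ℕ → ℕ → Set) →
          (∀ (a : Fin m) → R (toℕ a) (k + toℕ a)) → (∀ (b : Fin k) → R (m + toℕ b) (toℕ b)) →
          ∀ i → R (toℕ i) (toℕ (lookup (ξ m k) i))
ξ-graph m k R onLeft onRight i =
  subst (R (toℕ i)) (cong toℕ (sym (lookup∘tabulate _ i))) (splitAt-graph R _ _
    (λ a → subst (R (toℕ a)) (sym (trans (FP.toℕ-cast _ _) (FP.toℕ-↑ʳ k a))) (onLeft a))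
    (λ b → subst (R (m + toℕ b)) (sym (trans (FP.toℕ-cast _ _) (FP.toℕ-↑ˡ b m))) (onRight b)) i)

-- 1_{p-1} ∨ 1_k in 0-based values: p ↦ p + k, smaller entries fixed, larger ones shifted down by one.
VeeOneGraph : ℕ → ℕ → ℕ → ℕ → Set
VeeOneGraph p k i v = (i < p → v ≡ i) × (i ≡ p → v ≡ p + k) × (p < i → suc v ≡ i)

toℕ-vee-one : ∀ p k (i : Fin (suc (p + k))) → VeeOneGraph p k (toℕ i) (toℕ (lookup (vee (one p) (one k)) i))
toℕ-vee-one p k i = subst₂ (VeeOneGraph p k) (FP.toℕ-cast _ i)
  (sym (lookup-castW-tabulate {p + suc k} (+-suc p k) _ i))
  (splitAt-graph (VeeOneGraph p k) _ _ onLeft (λ { zero → onPivot ; (suc b) → onRight b }) (F.cast _ i))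
  where
  onLeft : ∀ (a : Fin p) → VeeOneGraph p k (toℕ a) (toℕ (lookup (one p) a ↑ˡ suc k))
  onLeft a rewrite FP.toℕ-↑ˡ (lookup (one p) a) (suc k) | lookup-one a =
    (λ _ → refl) , (λ a≡p → ⊥-elim (<-irrefl a≡p (FP.toℕ<n a))) , (λ p<a → ⊥-elim (<-asym p<a (FP.toℕ<n a)))
  onPivot : VeeOneGraph p k (p + 0) (toℕ (p ↑ʳ F.fromℕ k))
  onPivot rewrite FP.toℕ-↑ʳ p (F.fromℕ k) | FP.toℕ-fromℕ k | +-identityʳ p =
    (λ p<p → ⊥-elim (<-irrefl refl p<p)) , (λ _ → refl) , (λ p<p → ⊥-elim (<-irrefl refl p<p))
  onRight : ∀ (b : Fin k) → VeeOneGraph p k (p + suc (toℕ b)) (toℕ (p ↑ʳ F.inject₁ (lookup (one k) b)))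
  onRight b rewrite FP.toℕ-↑ʳ p (F.inject₁ (lookup (one k) b)) | FP.toℕ-inject₁ (lookup (one k) b) | lookup-one b
                  | +-suc p (toℕ b) =
    (λ p+b<p → ⊥-elim (<-asym p+b<p (s≤s (m≤m+n p (toℕ b))))) ,
    (λ p+b≡p → ⊥-elim (<-irrefl (sym p+b≡p) (s≤s (m≤m+n p (toℕ b))))) ,
    (λ _ → refl)

-- ξ_{m,q} × 1_1 in 0-based values: the first m entries move up by q, the next q down by m, the last is fixed.
ShiftGraph : ℕ → ℕ → ℕ → ℕ → Set
ShiftGraph m q i v = (i < m → v ≡ q + i) × (m ≤ i → i < m + q → m + v ≡ i) × (i ≡ m + q → v ≡ m + q)

toℕ-ξ×one : ∀ m q (i : Fin (m + suc q)) →
            ShiftGraph m q (toℕ i) (toℕ (lookup (castW (assoc1 m q) (ξ m q ×ₚ one 1)) i))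
toℕ-ξ×one m q i = subst₂ (ShiftGraph m q) (FP.toℕ-cast _ i) (sym (lookup-castW (assoc1 m q) (ξ m q ×ₚ one 1) i))
  (×ₚ-graph (ξ m q) (one 1) (ShiftGraph m q) (ξ-graph m q (ShiftGraph m q) onLeft onMiddle) onLast (F.cast _ i))
  where
  onLeft : ∀ (a : Fin m) → ShiftGraph m q (toℕ a) (q + toℕ a)
  onLeft a = (λ _ → refl) , (λ m≤a → ⊥-elim (<⇒≱ (FP.toℕ<n a) m≤a)) ,
             (λ a≡m+q → ⊥-elim (<-irrefl a≡m+q (<-≤-trans (FP.toℕ<n a) (m≤m+n m q))))
  onMiddle : ∀ (b : Fin q) → ShiftGraph m q (m + toℕ b) (toℕ b)
  onMiddle b = (λ m+b<m → ⊥-elim (<⇒≱ m+b<m (m≤m+n m (toℕ b)))) , (λ _ _ → refl) ,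
               (λ m+b≡m+q → ⊥-elim (<-irrefl (+-cancelˡ-≡ m _ _ m+b≡m+q) (FP.toℕ<n b)))
  onLast : ∀ (b : Fin 1) → ShiftGraph m q (m + q + toℕ b) (m + q + toℕ (lookup (one 1) b))
  onLast zero = (λ m+q+0<m → ⊥-elim (<⇒≱ m+q+0<m (≤-trans (m≤m+n m q) (m≤m+n _ 0)))) ,
                (λ _ m+q+0<m+q → ⊥-elim (<⇒≱ m+q+0<m+q (m≤m+n _ 0))) , (λ _ → +-identityʳ (m + q))

module Blocks (P Q : ℕ) where

  left : Word (P + Q) → Fin P → ℕ
  left g a = toℕ (lookup g (a ↑ˡ Q))

  right : Word (P + Q) → Fin Q → ℕ
  right g b = toℕ (lookup g (P ↑ʳ b))

  ↑ˡ<↑ʳ : ∀ (a : Fin P) (b : Fin Q) → toℕ (a ↑ˡ Q) < toℕ (P ↑ʳ b)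
  ↑ˡ<↑ʳ a b =
    subst₂ _<_ (sym (FP.toℕ-↑ˡ a Q)) (sym (FP.toℕ-↑ʳ P b)) (<-≤-trans (FP.toℕ<n a) (m≤m+n P (toℕ b)))

  ↑ʳ≢↑ˡ : ∀ (a : Fin P) (c : Fin Q) → P ↑ʳ c ≢ a ↑ˡ Q
  ↑ʳ≢↑ˡ a c e = <-irrefl (cong toℕ (sym e)) (↑ˡ<↑ʳ a c)

  infix 4 _⊆ᵇ_
  record _⊆ᵇ_ (A B : Word (P + Q)) : Set where
    field
      within-left  : ∀ a b → toℕ a < toℕ b → left A b < left A a → left B b < left B a
      within-right : ∀ c d → toℕ c < toℕ d → right A d < right A c → right B d < right B c
      across       : ∀ a c → right A c < left A a → right B c < left B a

  ⊆ᵇ⇒⊆ᵢ : ∀ {A B} → A ⊆ᵇ B → A ⊆ᵢ B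
  ⊆ᵇ⇒⊆ᵢ A⊆B i k (i<k , Ak<Ai) with blockView P Q i | blockView P Q k
  ... | inLeft a  | inLeft b  =
    i<k , _⊆ᵇ_.within-left A⊆B a b (subst₂ _<_ (FP.toℕ-↑ˡ a Q) (FP.toℕ-↑ˡ b Q) i<k) Ak<Ai
  ... | inRight c | inRight d =
    i<k , _⊆ᵇ_.within-right A⊆B c d
            (+-cancelˡ-< P _ _ (subst₂ _<_ (FP.toℕ-↑ʳ P c) (FP.toℕ-↑ʳ P d) i<k)) Ak<Ai
  ... | inLeft a  | inRight c = i<k , _⊆ᵇ_.across A⊆B a c Ak<Ai
  ... | inRight c | inLeft a  = ⊥-elim (<-asym i<k (↑ˡ<↑ʳ a c))

  ⊆ᵢ⇒⊆ᵇ : ∀ {A B} → A ⊆ᵢ B → A ⊆ᵇ B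
  ⊆ᵢ⇒⊆ᵇ A⊆B = record
    { within-left  = λ a b a<b → proj₂ ∘ A⊆B _ _ ∘
        (subst₂ _<_ (sym (FP.toℕ-↑ˡ a Q)) (sym (FP.toℕ-↑ˡ b Q)) a<b ,_)
    ; within-right = λ c d c<d → proj₂ ∘ A⊆B _ _ ∘
        (subst₂ _<_ (sym (FP.toℕ-↑ʳ P c)) (sym (FP.toℕ-↑ʳ P d)) (+-monoʳ-< P c<d) ,_)
    ; across       = λ a c → proj₂ ∘ A⊆B _ _ ∘ (↑ˡ<↑ʳ a c ,_)
    }

  ≤w⇒⊆ᵇ : ∀ {A B} → IsPerm A → A ≤w B → A ⊆ᵇ B
  ≤w⇒⊆ᵇ {A} {B} pA A≤B = ⊆ᵢ⇒⊆ᵇ (≤w⇒⊆ᵢ A B pA A≤B)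

  module _ (g : Word (P + Q)) (shuffle : IsShuffle P Q g) where

    shuffle-reflects-left : ∀ a b → left g a < left g b → toℕ a < toℕ b
    shuffle-reflects-left a b ga<gb with <-cmp (toℕ a) (toℕ b)
    ... | tri< a<b _ _ = a<b
    ... | tri≈ _ a≡b _ = ⊥-elim (<-irrefl (cong (left g) (FP.toℕ-injective a≡b)) ga<gb)
    ... | tri> _ _ b<a = ⊥-elim (<-asym ga<gb (proj₁ shuffle b a b<a))

    shuffle-reflects-right : ∀ c d → right g c < right g d → toℕ c < toℕ d
    shuffle-reflects-right c d gc<gd with <-cmp (toℕ c) (toℕ d)
    ... | tri< c<d _ _ = c<d
    ... | tri≈ _ c≡d _ = ⊥-elim (<-irrefl (cong (right g) (FP.toℕ-injective c≡d)) gc<gd)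
    ... | tri> _ _ d<c = ⊥-elim (<-asym gc<gd (proj₂ shuffle d c d<c))

  blockwise-IsPerm : ∀ g → (∀ a b → left g a ≡ left g b → a ≡ b) →
                     (∀ c d → right g c ≡ right g d → c ≡ d) → (∀ a c → left g a ≢ right g c) → IsPerm g
  blockwise-IsPerm g injˡ injʳ disjoint i k gi≡gk with blockView P Q i | blockView P Q k
  ... | inLeft a  | inLeft b  = cong (_↑ˡ Q) (injˡ a b (cong toℕ gi≡gk))
  ... | inRight c | inRight d = cong (P ↑ʳ_) (injʳ c d (cong toℕ gi≡gk))
  ... | inLeft a  | inRight c = ⊥-elim (disjoint a c (cong toℕ gi≡gk))
  ... | inRight c | inLeft a  = ⊥-elim (disjoint a c (cong toℕ (sym gi≡gk)))

  shuffle⇒IsPerm : ∀ g → IsShuffle P Q g → (∀ a c → left g a ≢ right g c) → IsPerm g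
  shuffle⇒IsPerm g (incˡ , incʳ) = blockwise-IsPerm g (injective incˡ) (injective incʳ)
    where
    injective : ∀ {m} {h : Fin m → ℕ} → (∀ a b → toℕ a < toℕ b → h a < h b) → ∀ a b → h a ≡ h b → a ≡ b
    injective inc a b ha≡hb with <-cmp (toℕ a) (toℕ b)
    ... | tri< a<b _ _ = ⊥-elim (<-irrefl ha≡hb (inc a b a<b))
    ... | tri≈ _ a≡b _ = FP.toℕ-injective a≡b
    ... | tri> _ _ b<a = ⊥-elim (<-irrefl (sym ha≡hb) (inc b a b<a))

  left-one : ∀ a → left (one (P + Q)) a ≡ toℕ a
  left-one a = trans (cong toℕ (lookup-one (a ↑ˡ Q))) (FP.toℕ-↑ˡ a Q)

  right-one : ∀ b → right (one (P + Q)) b ≡ P + toℕ b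
  right-one b = trans (cong toℕ (lookup-one (P ↑ʳ b))) (FP.toℕ-↑ʳ P b)

  IsShuffle-one : IsShuffle P Q (one (P + Q))
  IsShuffle-one = (λ a b a<b → subst₂ _<_ (sym (left-one a)) (sym (left-one b)) a<b)
                , (λ c d c<d → subst₂ _<_ (sym (right-one c)) (sym (right-one d)) (+-monoʳ-< P c<d))

  left-ξ : ∀ a → left (ξ P Q) a ≡ Q + toℕ a
  left-ξ = toℕ-ξ-↑ˡ P Q

  right-ξ : ∀ b → right (ξ P Q) b ≡ toℕ b
  right-ξ = toℕ-ξ-↑ʳ P Q

  IsShuffle-ξ : IsShuffle P Q (ξ P Q)
  IsShuffle-ξ = (λ a b a<b → subst₂ _<_ (sym (left-ξ a)) (sym (left-ξ b)) (+-monoʳ-< Q a<b))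
              , (λ c d c<d → subst₂ _<_ (sym (right-ξ c)) (sym (right-ξ d)) c<d)

  IsPerm-ξ : IsPerm (ξ P Q)
  IsPerm-ξ = shuffle⇒IsPerm (ξ P Q) IsShuffle-ξ λ a c ξa≡ξc →
    <-irrefl (sym (trans (sym (left-ξ a)) (trans ξa≡ξc (right-ξ c)))) (<-≤-trans (FP.toℕ<n c) (m≤m+n Q (toℕ a)))

  module Product (σ : Word P) (τ : Word Q) (pσ : IsPerm σ) (pτ : IsPerm τ) where

    x : Word (P + Q)
    x = σ ×ₚ τ

    left-x : ∀ a → left x a ≡ toℕ (lookup σ a)
    left-x a = trans (cong toℕ (lookup-×ₚ-↑ˡ σ τ a)) (FP.toℕ-↑ˡ _ Q)

    right-x : ∀ b → right x b ≡ P + toℕ (lookup τ b)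
    right-x b = trans (cong toℕ (lookup-×ₚ-↑ʳ σ τ b)) (FP.toℕ-↑ʳ P _)

    left-·x : ∀ g a → left (g · x) a ≡ left g (lookup σ a)
    left-·x g a = cong toℕ (trans (lookup-· g x (a ↑ˡ Q)) (cong (lookup g) (lookup-×ₚ-↑ˡ σ τ a)))

    right-·x : ∀ g b → right (g · x) b ≡ right g (lookup τ b)
    right-·x g b = cong toℕ (trans (lookup-· g x (P ↑ʳ b)) (cong (lookup g) (lookup-×ₚ-↑ʳ σ τ b)))

    IsPerm-x : IsPerm x
    IsPerm-x = blockwise-IsPerm x
      (λ a b xa≡xb → pσ a b (FP.toℕ-injective (trans (sym (left-x a)) (trans xa≡xb (left-x b)))))
      (λ c d xc≡xd → pτ c d (FP.toℕ-injective
                       (+-cancelˡ-≡ P _ _ (trans (sym (right-x c)) (trans xc≡xd (right-x d))))))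
      (λ a c xa≡xc → <-irrefl (trans (sym (left-x a)) (trans xa≡xc (right-x c)))
                               (<-≤-trans (FP.toℕ<n (lookup σ a)) (m≤m+n P _)))

    -- A shuffle preserves the order inside each block, so only cross-block inversions need checking.
    shuffle-·x-⊆ᵇ : ∀ g h → IsShuffle P Q g → IsShuffle P Q h →
                    (∀ a c → right (g · x) c < left (g · x) a → right (h · x) c < left (h · x) a) →
                    g · x ⊆ᵇ h · x
    shuffle-·x-⊆ᵇ g h sg sh across = record
      { within-left  = λ a b _ gxb<gxa → subst₂ _<_ (sym (left-·x h b)) (sym (left-·x h a))
          (proj₁ sh _ _ (shuffle-reflects-left g sg _ _ (subst₂ _<_ (left-·x g b) (left-·x g a) gxb<gxa)))
      ; within-right = λ c d _ gxd<gxc → subst₂ _<_ (sym (right-·x h d)) (sym (right-·x h c))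
          (proj₂ sh _ _ (shuffle-reflects-right g sg _ _ (subst₂ _<_ (right-·x g d) (right-·x g c) gxd<gxc)))
      ; across       = across
      }

    shuffle-·x-≤w : ∀ g h → IsPerm g → IsPerm h → IsShuffle P Q g → IsShuffle P Q h →
                    (∀ a c → right (g · x) c < left (g · x) a → right (h · x) c < left (h · x) a) →
                    g · x ≤w h · x
    shuffle-·x-≤w g h pg ph sg sh across =
      ⊆ᵢ⇒≤w (g · x) (h · x) (IsPerm-· g x pg IsPerm-x) (IsPerm-· h x ph IsPerm-x)
            (⊆ᵇ⇒⊆ᵢ (shuffle-·x-⊆ᵇ g h sg sh across))

    -- Conversely, a permutation whose inversion set lies between those of g · x and h · x, for
    -- shuffles g and h, is ω · x with ω a shuffle.
    module Between (π : Word (P + Q)) (pπ : IsPerm π) (g h : Word (P + Q))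
                   (sg : IsShuffle P Q g) (sh : IsShuffle P Q h) (gx⊆π : g · x ⊆ᵇ π) (π⊆hx : π ⊆ᵇ h · x) where

      left-order : ∀ a b → toℕ (lookup σ a) < toℕ (lookup σ b) → left π a < left π b
      left-order a b σa<σb with <-cmp (toℕ a) (toℕ b)
      ... | tri≈ _ a≡b _ = ⊥-elim (<-irrefl (cong (toℕ ∘ lookup σ) (FP.toℕ-injective a≡b)) σa<σb)
      ... | tri> _ _ b<a = _⊆ᵇ_.within-left gx⊆π b a b<a
                             (subst₂ _<_ (sym (left-·x g a)) (sym (left-·x g b)) (proj₁ sg _ _ σa<σb))
      ... | tri< a<b _ _ with <-cmp (left π a) (left π b)
      ...   | tri< πa<πb _ _ = πa<πb
      ...   | tri≈ _ πa≡πb _ =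
        ⊥-elim (<-irrefl (cong toℕ (FP.↑ˡ-injective Q a b (pπ _ _ (FP.toℕ-injective πa≡πb)))) a<b)
      ...   | tri> _ _ πb<πa = ⊥-elim (<-asym σa<σb (shuffle-reflects-left h sh _ _
                                 (subst₂ _<_ (left-·x h b) (left-·x h a) (_⊆ᵇ_.within-left π⊆hx a b a<b πb<πa))))

      right-order : ∀ c d → toℕ (lookup τ c) < toℕ (lookup τ d) → right π c < right π d
      right-order c d τc<τd with <-cmp (toℕ c) (toℕ d)
      ... | tri≈ _ c≡d _ = ⊥-elim (<-irrefl (cong (toℕ ∘ lookup τ) (FP.toℕ-injective c≡d)) τc<τd)
      ... | tri> _ _ d<c = _⊆ᵇ_.within-right gx⊆π d c d<c
                             (subst₂ _<_ (sym (right-·x g c)) (sym (right-·x g d)) (proj₂ sg _ _ τc<τd))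
      ... | tri< c<d _ _ with <-cmp (right π c) (right π d)
      ...   | tri< πc<πd _ _ = πc<πd
      ...   | tri≈ _ πc≡πd _ =
        ⊥-elim (<-irrefl (cong toℕ (FP.↑ʳ-injective P c d (pπ _ _ (FP.toℕ-injective πc≡πd)))) c<d)
      ...   | tri> _ _ πd<πc = ⊥-elim (<-asym τc<τd (shuffle-reflects-right h sh _ _
                                 (subst₂ _<_ (right-·x h d) (right-·x h c) (_⊆ᵇ_.within-right π⊆hx c d c<d πd<πc))))

      x⁻¹ : Word (P + Q)
      x⁻¹ = inverse x IsPerm-x

      ω : Word (P + Q)
      ω = π · x⁻¹

      left-ω : ∀ a → left ω a ≡ left π (lookup (inverse σ pσ) a)
      left-ω a = cong toℕ (trans (lookup-· π x⁻¹ (a ↑ˡ Q)) (cong (lookup π) (IsPerm-x _ _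
        (trans (lookup-inverseʳ x IsPerm-x (a ↑ˡ Q))
               (sym (trans (lookup-×ₚ-↑ˡ σ τ _) (cong (_↑ˡ Q) (lookup-inverseʳ σ pσ a))))))))

      right-ω : ∀ b → right ω b ≡ right π (lookup (inverse τ pτ) b)
      right-ω b = cong toℕ (trans (lookup-· π x⁻¹ (P ↑ʳ b)) (cong (lookup π) (IsPerm-x _ _
        (trans (lookup-inverseʳ x IsPerm-x (P ↑ʳ b))
               (sym (trans (lookup-×ₚ-↑ʳ σ τ _) (cong (P ↑ʳ_) (lookup-inverseʳ τ pτ b))))))))

      IsShuffle-ω : IsShuffle P Q ω
      IsShuffle-ω =
        (λ a b a<b → subst₂ _<_ (sym (left-ω a)) (sym (left-ω b)) (left-order _ _
           (subst₂ _<_ (cong toℕ (sym (lookup-inverseʳ σ pσ a))) (cong toℕ (sym (lookup-inverseʳ σ pσ b))) a<b))) ,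
        (λ c d c<d → subst₂ _<_ (sym (right-ω c)) (sym (right-ω d)) (right-order _ _
           (subst₂ _<_ (cong toℕ (sym (lookup-inverseʳ τ pτ c))) (cong toℕ (sym (lookup-inverseʳ τ pτ d))) c<d)))

      IsPerm-ω : IsPerm ω
      IsPerm-ω = IsPerm-· π x⁻¹ pπ (IsPerm-inverse x IsPerm-x)

      ω·x≡π : ω · x ≡ π
      ω·x≡π = trans (sym (·-assoc π x⁻¹ x)) (trans (cong (π ·_) (·-inverseˡ x IsPerm-x)) (·-identityʳ π))

module Interval (p q : ℕ) where

  P Q : ℕ
  P = suc p
  Q = suc q

  open Blocks P Q

  P+Q≡1+P+q : P + Q ≡ suc (P + q)
  P+Q≡1+P+q = +-suc P q

  u : Word (P + Q)
  u = vee (one p) (one Q)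

  left-u-pivot : ∀ c → toℕ c ≡ p → left u c ≡ p + Q
  left-u-pivot c c≡p = proj₁ (proj₂ (toℕ-vee-one p Q (c ↑ˡ Q))) (trans (FP.toℕ-↑ˡ c Q) c≡p)

  left-u : ∀ c → (toℕ c < p × left u c ≡ toℕ c) ⊎ (toℕ c ≡ p × left u c ≡ p + Q)
  left-u c with <-cmp (toℕ c) p | toℕ-vee-one p Q (c ↑ˡ Q)
  ... | tri< c<p _ _ | below , _ , _ =
    inj₁ (c<p , trans (below (subst (_< p) (sym (FP.toℕ-↑ˡ c Q)) c<p)) (FP.toℕ-↑ˡ c Q))
  ... | tri≈ _ c≡p _ | _ = inj₂ (c≡p , left-u-pivot c c≡p)
  ... | tri> _ _ p<c | _ = ⊥-elim (<⇒≱ (FP.toℕ<n c) p<c)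

  right-u : ∀ d → right u d ≡ p + toℕ d
  right-u d = suc-injective (trans (proj₂ (proj₂ (toℕ-vee-one p Q (P ↑ʳ d)))
                (subst (p <_) (sym (FP.toℕ-↑ʳ P d)) (s≤s (m≤m+n p (toℕ d))))) (FP.toℕ-↑ʳ P d))

  IsShuffle-u : IsShuffle P Q u
  IsShuffle-u = increasingˡ , (λ c d c<d → subst₂ _<_ (sym (right-u c)) (sym (right-u d)) (+-monoʳ-< p c<d))
    where
    increasingˡ : ∀ a b → toℕ a < toℕ b → left u a < left u b
    increasingˡ a b a<b with left-u a | left-u b
    ... | inj₁ (_ , ua)   | inj₁ (_ , ub)   = subst₂ _<_ (sym ua) (sym ub) a<b
    ... | inj₁ (a<p , ua) | inj₂ (_ , ub)   = subst₂ _<_ (sym ua) (sym ub) (<-≤-trans a<p (m≤m+n p Q))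
    ... | inj₂ (a≡p , _)  | inj₁ (b<p , _)  = ⊥-elim (<-asym a<b (subst (toℕ b <_) (sym a≡p) b<p))
    ... | inj₂ (a≡p , _)  | inj₂ (b≡p , _)  = ⊥-elim (<-irrefl (trans a≡p (sym b≡p)) a<b)

  IsPerm-u : IsPerm u
  IsPerm-u = shuffle⇒IsPerm u IsShuffle-u disjoint
    where
    disjoint : ∀ a c → left u a ≢ right u c
    disjoint a c ua≡uc with left-u a
    ... | inj₁ (a<p , ua) = <-irrefl (trans (sym ua) (trans ua≡uc (right-u c))) (<-≤-trans a<p (m≤m+n p (toℕ c)))
    ... | inj₂ (_ , ua)   = <-irrefl (sym (trans (sym ua) (trans ua≡uc (right-u c)))) (+-monoʳ-< p (FP.toℕ<n c))

  y : Word (P + Q)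
  y = castW (assoc1 P q) (ξ P q ×ₚ one 1)

  left-y : ∀ a → left y a ≡ q + toℕ a
  left-y a = trans (proj₁ (toℕ-ξ×one P q (a ↑ˡ Q)) (subst (_< P) (sym (FP.toℕ-↑ˡ a Q)) (FP.toℕ<n a)))
                   (cong (q +_) (FP.toℕ-↑ˡ a Q))

  right-y-last : ∀ d → toℕ d ≡ q → right y d ≡ P + q
  right-y-last d d≡q = proj₂ (proj₂ (toℕ-ξ×one P q (P ↑ʳ d))) (trans (FP.toℕ-↑ʳ P d) (cong (P +_) d≡q))

  right-y : ∀ d → (toℕ d < q × right y d ≡ toℕ d) ⊎ (toℕ d ≡ q × right y d ≡ P + q)
  right-y d with <-cmp (toℕ d) q | toℕ-ξ×one P q (P ↑ʳ d)
  ... | tri< d<q _ _ | _ , middle , _ = inj₁ (d<q , +-cancelˡ-≡ P _ _ (trans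
          (middle (subst (P ≤_) (sym (FP.toℕ-↑ʳ P d)) (m≤m+n P (toℕ d)))
                  (subst (_< P + q) (sym (FP.toℕ-↑ʳ P d)) (+-monoʳ-< P d<q)))
          (FP.toℕ-↑ʳ P d)))
  ... | tri≈ _ d≡q _ | _ = inj₂ (d≡q , right-y-last d d≡q)
  ... | tri> _ _ q<d | _ = ⊥-elim (<⇒≱ (FP.toℕ<n d) q<d)

  IsShuffle-y : IsShuffle P Q y
  IsShuffle-y = (λ a b a<b → subst₂ _<_ (sym (left-y a)) (sym (left-y b)) (+-monoʳ-< q a<b)) , increasingʳ
    where
    increasingʳ : ∀ c d → toℕ c < toℕ d → right y c < right y d
    increasingʳ c d c<d with right-y c | right-y d
    ... | inj₁ (_ , yc)   | inj₁ (_ , yd)   = subst₂ _<_ (sym yc) (sym yd) c<d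
    ... | inj₁ (c<q , yc) | inj₂ (_ , yd)   = subst₂ _<_ (sym yc) (sym yd) (<-≤-trans c<q (m≤n+m q P))
    ... | inj₂ (c≡q , _)  | inj₁ (d<q , _)  = ⊥-elim (<-asym c<d (subst (toℕ d <_) (sym c≡q) d<q))
    ... | inj₂ (c≡q , _)  | inj₂ (d≡q , _)  = ⊥-elim (<-irrefl (trans c≡q (sym d≡q)) c<d)

  IsPerm-y : IsPerm y
  IsPerm-y = shuffle⇒IsPerm y IsShuffle-y disjoint
    where
    disjoint : ∀ a c → left y a ≢ right y c
    disjoint a c ya≡yc with right-y c
    ... | inj₁ (c<q , yc) = <-irrefl (sym (trans (sym (left-y a)) (trans ya≡yc yc))) (<-≤-trans c<q (m≤m+n q (toℕ a)))
    ... | inj₂ (_ , yc)   = <-irrefl (trans (sym (left-y a)) (trans ya≡yc yc))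
                              (subst (q + toℕ a <_) (+-comm q P) (+-monoʳ-< q (FP.toℕ<n a)))

  module _ (σ : Word P) (τ : Word Q) (pσ : IsPerm σ) (pτ : IsPerm τ) where

    open Product σ τ pσ pτ

    -- The cross-block inversions of u · x are the pairs (a, c) with σ a = p, the top value of σ.
    -- For a shuffle ω, ω · x has them all iff ω sends the last left position above every other one,
    -- which is Sh².
    Sh²⇒interval : ∀ ω → IsPerm ω → Sh² P Q ω → u · x ≤w ω · x × ω · x ≤w ξ P Q · x
    Sh²⇒interval ω pω (sω , top) = shuffle-·x-≤w u ω IsPerm-u pω IsShuffle-u sω across-u
                                 , shuffle-·x-≤w ω (ξ P Q) pω IsPerm-ξ sω IsShuffle-ξ across-ξ
      where
      across-u : ∀ a c → right (u · x) c < left (u · x) a → right (ω · x) c < left (ω · x) a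
      across-u a c uxc<uxa with left-u (lookup σ a)
      ... | inj₁ (σa<p , uσa) = ⊥-elim (<-asym uxc<uxa (subst₂ _<_ (sym (trans (left-·x u a) uσa))
              (sym (trans (right-·x u c) (right-u (lookup τ c)))) (<-≤-trans σa<p (m≤m+n p (toℕ (lookup τ c))))))
      ... | inj₂ (σa≡p , _) = subst₂ _<_ (sym (right-·x ω c)) (sym (left-·x ω a))
              (maximal⇒dominant ω pω (lookup σ a ↑ˡ Q) (top _ (cong suc (trans (FP.toℕ-↑ˡ (lookup σ a) Q) σa≡p)))
                                (P ↑ʳ lookup τ c) (↑ʳ≢↑ˡ (lookup σ a) (lookup τ c)))
      across-ξ : ∀ a c → right (ω · x) c < left (ω · x) a → right (ξ P Q · x) c < left (ξ P Q · x) a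
      across-ξ a c _ = subst₂ _<_ (sym (trans (right-·x (ξ P Q) c) (right-ξ (lookup τ c))))
                                  (sym (trans (left-·x (ξ P Q) a) (left-ξ (lookup σ a))))
                                  (<-≤-trans (FP.toℕ<n (lookup τ c)) (m≤m+n Q (toℕ (lookup σ a))))

    interval⇒Sh² : ∀ π → IsPerm π → u · x ≤w π × π ≤w ξ P Q · x →
                   Σ[ ω ∈ Word (P + Q) ] IsPerm ω × Sh² P Q ω × ω · x ≡ π
    interval⇒Sh² π pπ (ux≤π , π≤ξx) = ω , IsPerm-ω , (IsShuffle-ω , top) , ω·x≡π
      where
      ux⊆π : u · x ⊆ᵇ π
      ux⊆π = ≤w⇒⊆ᵇ (IsPerm-· u x IsPerm-u IsPerm-x) ux≤π
      open Between π pπ u (ξ P Q) IsShuffle-u IsShuffle-ξ ux⊆π (≤w⇒⊆ᵇ pπ π≤ξx)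
      top : ∀ i → suc (toℕ i) ≡ P → suc (toℕ (lookup ω i)) ≡ P + Q
      top i 1+i≡P with blockView P Q i
      ... | inRight d =
        ⊥-elim (<-irrefl (sym (trans (cong suc (sym (FP.toℕ-↑ʳ P d))) 1+i≡P)) (s≤s (m≤m+n P (toℕ d))))
      ... | inLeft c  = trans (cong suc (left-ω c)) (dominant⇒maximal π pπ (a ↑ˡ Q) dominant)
        where
        a : Fin P
        a = lookup (inverse σ pσ) c
        σa≡p : toℕ (lookup σ a) ≡ p
        σa≡p = trans (cong toℕ (lookup-inverseʳ σ pσ c)) (trans (sym (FP.toℕ-↑ˡ c Q)) (suc-injective 1+i≡P))
        dominant : ∀ k → k ≢ a ↑ˡ Q → toℕ (lookup π k) < toℕ (lookup π (a ↑ˡ Q))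
        dominant k k≢a with blockView P Q k
        ... | inLeft b  = left-order b a (maximal⇒dominant σ pσ a (cong suc σa≡p) b (k≢a ∘ cong (_↑ˡ Q)))
        ... | inRight d = _⊆ᵇ_.across ux⊆π a d (subst₂ _<_ (sym (trans (right-·x u d) (right-u (lookup τ d))))
                            (sym (trans (left-·x u a) (left-u-pivot (lookup σ a) σa≡p)))
                            (+-monoʳ-< p (FP.toℕ<n (lookup τ d))))

    -- y · x inverts every cross-block pair except the (a, c) with τ c = q, the top value of τ.
    -- For a shuffle ω, ω · x avoids these iff ω sends the last right position above every other one,
    -- which is Sh¹.
    Sh¹⇒interval : ∀ ω → IsPerm ω → Sh¹ P Q ω → x ≤w ω · x × ω · x ≤w y · x
    Sh¹⇒interval ω pω (sω , top) =
      subst (_≤w ω · x) (·-identityˡ x) (shuffle-·x-≤w (one (P + Q)) ω IsPerm-one pω IsShuffle-one sω across-one) ,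
      shuffle-·x-≤w ω y pω IsPerm-y sω IsShuffle-y across-y
      where
      across-one : ∀ a c → right (one (P + Q) · x) c < left (one (P + Q) · x) a → right (ω · x) c < left (ω · x) a
      across-one a c xc<xa = ⊥-elim (<-asym xc<xa (subst₂ _<_
        (sym (trans (left-·x (one (P + Q)) a) (left-one (lookup σ a))))
        (sym (trans (right-·x (one (P + Q)) c) (right-one (lookup τ c))))
        (<-≤-trans (FP.toℕ<n (lookup σ a)) (m≤m+n P (toℕ (lookup τ c))))))
      across-y : ∀ a c → right (ω · x) c < left (ω · x) a → right (y · x) c < left (y · x) a
      across-y a c ωxc<ωxa with right-y (lookup τ c)
      ... | inj₁ (τc<q , yτc) =
        subst₂ _<_ (sym (trans (right-·x y c) yτc)) (sym (trans (left-·x y a) (left-y (lookup σ a))))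
                   (<-≤-trans τc<q (m≤m+n q (toℕ (lookup σ a))))
      ... | inj₂ (τc≡q , _)   = ⊥-elim (<-asym ωxc<ωxa (subst₂ _<_ (sym (left-·x ω a)) (sym (right-·x ω c))
              (maximal⇒dominant ω pω (P ↑ʳ lookup τ c)
                 (top _ (trans (cong suc (trans (FP.toℕ-↑ʳ P (lookup τ c)) (cong (P +_) τc≡q))) (sym P+Q≡1+P+q)))
                 (lookup σ a ↑ˡ Q) (↑ʳ≢↑ˡ (lookup σ a) (lookup τ c) ∘ sym))))

    interval⇒Sh¹ : ∀ π → IsPerm π → x ≤w π × π ≤w y · x →
                   Σ[ ω ∈ Word (P + Q) ] IsPerm ω × Sh¹ P Q ω × ω · x ≡ π
    interval⇒Sh¹ π pπ (x≤π , π≤yx) = ω , IsPerm-ω , (IsShuffle-ω , top) , ω·x≡π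
      where
      π⊆yx : π ⊆ᵇ y · x
      π⊆yx = ≤w⇒⊆ᵇ pπ π≤yx
      open Between π pπ (one (P + Q)) y IsShuffle-one IsShuffle-y
                   (subst (_⊆ᵇ π) (sym (·-identityˡ x)) (≤w⇒⊆ᵇ IsPerm-x x≤π)) π⊆yx
      top : ∀ i → suc (toℕ i) ≡ P + Q → suc (toℕ (lookup ω i)) ≡ P + Q
      top i 1+i≡P+Q with blockView P Q i
      ... | inLeft c  = ⊥-elim (<⇒≱ (m<m+n P {Q} z<s)
                          (subst (_≤ P) (trans (cong suc (sym (FP.toℕ-↑ˡ c Q))) 1+i≡P+Q) (FP.toℕ<n c)))
      ... | inRight c = trans (cong suc (right-ω c)) (dominant⇒maximal π pπ (P ↑ʳ d) dominant)
        where
        d : Fin Q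
        d = lookup (inverse τ pτ) c
        τd≡q : toℕ (lookup τ d) ≡ q
        τd≡q = trans (cong toℕ (lookup-inverseʳ τ pτ c))
                 (+-cancelˡ-≡ P _ _ (suc-injective
                   (trans (trans (cong suc (sym (FP.toℕ-↑ʳ P c))) 1+i≡P+Q) P+Q≡1+P+q)))
        dominant : ∀ k → k ≢ P ↑ʳ d → toℕ (lookup π k) < toℕ (lookup π (P ↑ʳ d))
        dominant k k≢d with blockView P Q k
        ... | inRight b = right-order b d (maximal⇒dominant τ pτ d (cong suc τd≡q) b (k≢d ∘ cong (P ↑ʳ_)))
        ... | inLeft b with <-cmp (left π b) (right π d)
        ...   | tri< πb<πd _ _ = πb<πd
        ...   | tri≈ _ πb≡πd _ = ⊥-elim (k≢d (pπ _ _ (FP.toℕ-injective πb≡πd)))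
        ...   | tri> _ _ πd<πb = ⊥-elim (<-asym (_⊆ᵇ_.across π⊆yx b d πd<πb)
                  (subst₂ _<_ (sym (trans (left-·x y b) (left-y (lookup σ b))))
                              (sym (trans (right-·x y d) (right-y-last (lookup τ d) τd≡q)))
                              (subst (q + toℕ (lookup σ b) <_) (+-comm q P) (+-monoʳ-< q (FP.toℕ<n (lookup σ b))))))

proposition4p6 : ∀ (p q : ℕ) (σ : Word (suc p)) (τ : Word (suc q)) → IsPerm σ → IsPerm τ →
    SumEq (suc p + suc q) (Sh² (suc p) (suc q)) (λ ω → ω · (σ ×ₚ τ))
      (λ ω → (vee (one p) (one (suc q)) · (σ ×ₚ τ)) ≤w ω × ω ≤w (σ ∖ₚ τ))
    × SumEq (suc p + suc q) (Sh¹ (suc p) (suc q)) (λ ω → ω · (σ ×ₚ τ))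
      (λ ω → (σ /ₚ τ) ≤w ω × ω ≤w (castW (assoc1 (suc p) q) (ξ (suc p) q ×ₚ one 1) · (σ ×ₚ τ)))
proposition4p6 p q σ τ pσ pτ =
  SumEq-·ʳ x IsPerm-x _ _ (Sh²⇒interval σ τ pσ pτ) (interval⇒Sh² σ τ pσ pτ) ,
  SumEq-·ʳ x IsPerm-x _ _ (Sh¹⇒interval σ τ pσ pτ) (interval⇒Sh¹ σ τ pσ pτ)
  where
  open Interval p q
  open Blocks.Product (suc p) (suc q) σ τ pσ pτ
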